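{- For any integers $s > 0$, $m > 0$ and $r \ge 0$, the following identities of operators on $\operatorname{NSym}$ hold: \begin{align*} &\sum_{i\geq 0} \mathbb{B}_i F^\perp_i = \mathrm{Id}, \qquad \sum_{i\geq -s} \mathbb{B}_i F^\perp_{i + s} = 0, \qquad \mathbb{B}_0 = \mathrm{Id} - \sum_{i\geq 1} \mathbb{B}_i F^\perp_i, \qquad \mathbb{B}_{ -s} = - \sum_{i > -s} \mathbb{B}_i F^\perp_{i + s},\\ &F^\perp_r \mathbb{B}_m = \sum^r_{i = 0} \mathbb{B}_{m - i} F^\perp_{r - i} \ \text{ if } m>r, \qquad F^\perp_m \mathbb{B}_m = \mathrm{Id} -\sum_{i \geq 1} \mathbb{B}_{m + i} F^\perp_{m + i}, \qquad F^\perp_r \mathbb{B}_m = -\sum_{i \geq 1} \mathbb{B}_{m + i} F^\perp_{r + i} \ \text{ if } m<r. \end{align*}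
   Context: $\operatorname{NSym}$ is the free associative algebra over $\mathbb{Q}$ on generators $H_1, H_2, \dots$ ($H_i$ of degree $i$), with $H_0 = 1$, $H_{ -r} = 0$ for $r>0$. $\operatorname{QSym}$ is the algebra of quasi-symmetric functions, dual to $\operatorname{NSym}$ via $\langle H_\alpha, M_\beta\rangle = \delta_{\alpha,\beta}$ ($H_\alpha = H_{\alpha_1}\cdots H_{\alpha_m}$, $M_\beta$ monomial quasi-symmetric functions). The fundamental quasi-symmetric function is $F_\alpha = \sum_{\beta \le \alpha} M_\beta$ (sum over refinements $\beta$ of $\alpha$); $F_r$ is indexed by $[r]$, $F_{1^i}$ by $i$ ones, $F_0 = 1$, $F_d = 0$ for $d < 0$. For $F\in\operatorname{QSym}$, $F^\perp$ is the operator on $\operatorname{NSym}$ with $\langle F^\perp H, G\rangle = \langle H, FG\rangle$ for all $G\in\operatorname{QSym}$. $H_m^L$ is left multiplication by $H_m$. For $m\in\mathbb{Z}$, $\mathbb{B}_m = \sum_{i\ge 0}(-1)^i H^L_{m+i} F^\perp_{1^i}$. All infinite sums above are finite when applied to any element of $\operatorname{NSym}$. -}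

module Defs where

open import Data.Nat as ℕ using (ℕ; zero; suc; _≤ᵇ_; _∸_)
open import Data.Integer as ℤ using (ℤ; +_; -[1+_])
open import Data.Rational as ℚ using (ℚ; 0ℚ; 1ℚ)
open import Data.List using (List; []; _∷_; _++_; map; concatMap; replicate; foldr)
open import Data.Nat.ListAction using (sum)
open import Data.List.Properties using (≡-dec)
open import Data.Product using (_×_; _,_)
open import Data.Bool using (Bool; true; false; if_then_else_)
open import Relation.Nullary.Decidable using (Dec; does)
open import Relation.Binary.PropositionalEquality using (_≡_)

-- Words / compositions.  A composition is a list of positive naturals.
-- A word may contain zeros; H_0 = 1, so zeros are dropped (normalise).

Word : Set
Word = List ℕ

normalise : Word → Word
normalise [] = []
normalise (zero ∷ w) = normalise w
normalise (suc a ∷ w) = suc a ∷ normalise w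

size : Word → ℕ
size = sum

_≟w_ : (u v : Word) → Dec (u ≡ v)
_≟w_ = ≡-dec ℕ._≟_

comps : ℕ → List Word
comps zero = [] ∷ []
comps (suc n) = concatMap ext (comps n)
  where
  ext : Word → List Word
  ext [] = (1 ∷ []) ∷ []
  ext (a ∷ r) = (1 ∷ a ∷ r) ∷ (suc a ∷ r) ∷ []

refinements : Word → List Word
refinements [] = [] ∷ []
refinements (a ∷ α) =
  concatMap (λ c → map (λ r → c ++ r) (refinements α)) (comps a)

-- quasi-shuffle (overlapping shuffle): M_α M_β = Σ_{γ ∈ qsh α β} M_γ
qsh : Word → Word → List Word
qsh [] β = β ∷ []
qsh (a ∷ α) [] = (a ∷ α) ∷ []
qsh (a ∷ α) (b ∷ β) =
     map (a ∷_) (qsh α (b ∷ β))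
  ++ map (b ∷_) (qsh (a ∷ α) β)
  ++ map (ℕ._+_ a b ∷_) (qsh α β)

-- QSym in the M-basis: finite formal sums Σ c_δ M_δ (list of (coeff, index))

QSym : Set
QSym = List (ℚ × Word)

Fq : Word → QSym
Fq α = map (λ β → (1ℚ , β)) (refinements α)

_·Q_ : QSym → QSym → QSym
f ·Q g = concatMap (λ { (c , δ) →
           concatMap (λ { (d , ε) → map (λ γ → (c ℚ.* d , γ)) (qsh δ ε) }) g }) f

-- NSym: finite formal sums Σ c_w H_w (H_w = H_{w_1} ⋯ H_{w_k})

NSym : Set
NSym = List (ℚ × Word)

0N : NSym
0N = []

_⊕_ : NSym → NSym → NSym
_⊕_ = _++_

scale : ℚ → NSym → NSym
scale c = map (λ { (d , w) → (c ℚ.* d , w) })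

⊖_ : NSym → NSym
⊖ x = scale (ℚ.- 1ℚ) x

_⊖_ : NSym → NSym → NSym
x ⊖ y = x ⊕ (⊖ y)

coeff : NSym → Word → ℚ
coeff x γ = foldr (λ { (c , w) acc →
  if does (normalise w ≟w γ) then c ℚ.+ acc else acc }) 0ℚ x

_≈_ : NSym → NSym → Set
x ≈ y = ∀ γ → coeff x γ ≡ coeff y γ

deg : NSym → ℕ
deg = foldr (λ { (_ , w) acc → size w ℕ.⊔ acc }) 0

-- duality pairing ⟨H_β, f⟩ for f ∈ QSym (⟨H_α, M_δ⟩ = δ_{α,δ})
pairH : Word → QSym → ℚ
pairH β f = foldr (λ { (c , δ) acc →
  if does (δ ≟w β) then c ℚ.+ acc else acc }) 0ℚ f

Op : Set
Op = NSym → NSym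

-- F^⊥ for f ∈ QSym homogeneous of degree k, defined by duality:
-- the coefficient of H_γ in f^⊥ H_β is ⟨H_β, f M_γ⟩, |γ| = |β| - k.
perpHom : ℕ → QSym → Op
perpHom k f x = concatMap (λ { (c , w) → term c (normalise w) }) x
  where
  term : ℚ → Word → NSym
  term c β = if k ≤ᵇ size β
    then map (λ γ → (c ℚ.* pairH β (f ·Q ((1ℚ , γ) ∷ [])) , γ)) (comps (size β ∸ k))
    else []

Fperp : Word → Op
Fperp α = perpHom (size α) (Fq α)

-- F^⊥_r for r ∈ ℤ : F_0 = 1, F_r = 0 for r < 0
F⊥ : ℤ → Op
F⊥ (+ zero) = Fperp []
F⊥ (+ suc r) = Fperp (suc r ∷ [])
F⊥ -[1+ _ ] = λ _ → 0N

F⊥1 : ℕ → Op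
F⊥1 i = Fperp (replicate i 1)

-- left multiplication by H_m, m ∈ ℤ (H_0 = 1, H_m = 0 for m < 0)
HL : ℤ → Op
HL (+ zero) x = x
HL (+ suc n) x = map (λ { (c , w) → (c , suc n ∷ w) }) x
HL -[1+ _ ] x = 0N

sign : ℕ → ℚ
sign zero = 1ℚ
sign (suc i) = ℚ.- sign i

sumFrom : ℤ → ℕ → (ℤ → NSym) → NSym
sumFrom a zero f = 0N
sumFrom a (suc n) f = f a ⊕ sumFrom (a ℤ.+ + 1) n f

sumℕ : ℕ → (ℕ → NSym) → NSym
sumℕ zero f = 0N
sumℕ (suc n) f = sumℕ n f ⊕ f n

-- 𝔹_m = Σ_{i ≥ 0} (-1)^i H^L_{m+i} F^⊥_{1^i}; on x the terms with i > deg x vanish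
𝔹 : ℤ → Op
𝔹 m x = sumℕ (suc (deg x)) (λ i → scale (sign i) (HL (m ℤ.+ + i) (F⊥1 i x)))

-- Σ_{i ≥ a} 𝔹_i F^⊥_{i+c} applied to x, for a + c ≥ 0; all terms with
-- i ≥ a + deg x + 1 vanish (F^⊥_r x = 0 for r > deg x), so the sum is truncated there.
Σ𝔹F : (a c : ℤ) → Op
Σ𝔹F a c x = sumFrom a (suc (deg x)) (λ i → 𝔹 i (F⊥ (i ℤ.+ c) x))

module Submission where

-- Since the coefficient of H_γ in f^⊥ x is ⟨x, f M_γ⟩
-- and F_r = Σ_{δ ⊨ r} M_δ, the quasi-shuffle product yields the Leibniz rules
--   F^⊥_r H_b = Σ_{j ≤ r} H_{b-j} F^⊥_{r-j},   F^⊥_{1^k} H_b = H_b F^⊥_{1^k} + H_{b-1} F^⊥_{1^{k-1}}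
-- (H_b acting by left multiplication).  Induction on words then shows that F^⊥_r and F^⊥_{1^k}
-- commute and that Σ_{k ≤ t} (-1)^k F^⊥_{1^k} F^⊥_{t-k} = 0 for t > 0.  The first fact gives
-- F^⊥_r 𝔹_m = Σ_{k ≤ r} 𝔹_{m-k} F^⊥_{r-k}; the second collapses Σ_{p ≥ 0} 𝔹_{a+p} F^⊥_p, regrouped
-- along its diagonals, to H_a.  Each identity of the corollary is a rearrangement of these two.

open import Algebra.Bundles using (CommutativeMonoid)
open import Data.List using (List; []; _∷_; _++_; map; concat; concatMap; replicate)
open import Data.List.Relation.Unary.All as All using (All; []; _∷_)
open import Data.Nat as ℕ using (ℕ; zero; suc; _∸_; _<_; _≤_; _≤ᵇ_; _⊔_; z≤n; s≤s)
import Data.Nat.Properties as ℕ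
open import Function using (_∘_)
import Relation.Binary.PropositionalEquality as ≡
open ≡ using (_≡_)

module CommutativeMonoidSums {c ℓ} (M : CommutativeMonoid c ℓ) where

  open import Data.Nat using (_+_)
  open CommutativeMonoid M renaming (Carrier to A)
  open import Algebra.Properties.CommutativeSemigroup commutativeSemigroup using (interchange)
  open import Relation.Binary.Reasoning.Setoid setoid

  Σ< : ℕ → (ℕ → A) → A
  Σ< zero    f = ε
  Σ< (suc n) f = Σ< n f ∙ f n

  Σ<-cong : ∀ n {f g : ℕ → A} → (∀ i → i < n → f i ≈ g i) → Σ< n f ≈ Σ< n g
  Σ<-cong zero    f≈g = refl
  Σ<-cong (suc n) f≈g = ∙-cong (Σ<-cong n (λ i i<n → f≈g i (ℕ.m<n⇒m<1+n i<n))) (f≈g n ℕ.≤-refl)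

  Σ<-zero : ∀ n {f : ℕ → A} → (∀ i → i < n → f i ≈ ε) → Σ< n f ≈ ε
  Σ<-zero zero    f≈ε = refl
  Σ<-zero (suc n) f≈ε = trans (∙-cong (Σ<-zero n (λ i i<n → f≈ε i (ℕ.m<n⇒m<1+n i<n))) (f≈ε n ℕ.≤-refl)) (identityˡ ε)

  Σ<-distrib : ∀ n (f g : ℕ → A) → Σ< n (λ i → f i ∙ g i) ≈ Σ< n f ∙ Σ< n g
  Σ<-distrib zero    f g = sym (identityˡ ε)
  Σ<-distrib (suc n) f g = trans (∙-cong (Σ<-distrib n f g) refl) (interchange _ _ _ _)

  Σ<-head : ∀ n (f : ℕ → A) → Σ< (suc n) f ≈ f 0 ∙ Σ< n (f ∘ suc)
  Σ<-head zero    f = trans (identityˡ (f 0)) (sym (identityʳ (f 0)))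
  Σ<-head (suc n) f = trans (∙-cong (Σ<-head n f) refl) (assoc (f 0) _ _)

  Σ<-split : ∀ n m (f : ℕ → A) → Σ< (n + m) f ≈ Σ< n f ∙ Σ< m (λ i → f (n + i))
  Σ<-split n zero    f = ≡.subst (λ k → Σ< k f ≈ Σ< n f ∙ ε) (≡.sym (ℕ.+-identityʳ n)) (sym (identityʳ _))
  Σ<-split n (suc m) f = begin
    Σ< (n + suc m) f                                  ≡⟨ ≡.cong (λ k → Σ< k f) (ℕ.+-suc n m) ⟩
    Σ< (n + m) f ∙ f (n + m)                          ≈⟨ ∙-cong (Σ<-split n m f) refl ⟩
    (Σ< n f ∙ Σ< m (λ i → f (n + i))) ∙ f (n + m)     ≈⟨ assoc _ _ _ ⟩
    Σ< n f ∙ Σ< (suc m) (λ i → f (n + i))             ∎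

  Σ<-truncate : ∀ {m n} (f : ℕ → A) → m ≤ n → (∀ i → m ≤ i → i < n → f i ≈ ε) → Σ< n f ≈ Σ< m f
  Σ<-truncate {m} {n} f m≤n vanish = begin
    Σ< n f                                ≡⟨ ≡.cong (λ k → Σ< k f) (≡.sym (ℕ.m+[n∸m]≡n m≤n)) ⟩
    Σ< (m + (n ∸ m)) f                    ≈⟨ Σ<-split m (n ∸ m) f ⟩
    Σ< m f ∙ Σ< (n ∸ m) (λ i → f (m + i)) ≈⟨ ∙-cong refl (Σ<-zero (n ∸ m) tail) ⟩
    Σ< m f ∙ ε                            ≈⟨ identityʳ _ ⟩
    Σ< m f                                ∎
    where
    tail : ∀ i → i < n ∸ m → f (m + i) ≈ ε
    tail i i<n∸m = vanish (m + i) (ℕ.m≤m+n m i)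
      (≡.subst (m + i <_) (ℕ.m+[n∸m]≡n m≤n) (ℕ.+-monoʳ-< m i<n∸m))

  Σ<-comm : ∀ n m (F : ℕ → ℕ → A) → Σ< n (λ i → Σ< m (F i)) ≈ Σ< m (λ j → Σ< n (λ i → F i j))
  Σ<-comm zero    m F = sym (Σ<-zero m (λ _ _ → refl))
  Σ<-comm (suc n) m F = trans (∙-cong (Σ<-comm n m F) refl) (sym (Σ<-distrib m _ (F n)))

  Σ<-reverse : ∀ n (f : ℕ → A) → Σ< n f ≈ Σ< n (λ i → f (n ∸ suc i))
  Σ<-reverse zero    f = refl
  Σ<-reverse (suc n) f = begin
    Σ< n f ∙ f n                                ≈⟨ comm _ _ ⟩
    f n ∙ Σ< n f                                ≈⟨ ∙-cong refl (Σ<-reverse n f) ⟩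
    f n ∙ Σ< n (λ i → f (n ∸ suc i))            ≈⟨ sym (Σ<-head n _) ⟩
    Σ< (suc n) (λ i → f (suc n ∸ suc i))        ∎

  Σ<-triangle : ∀ N (g : ℕ → ℕ → A) →
    Σ< N (λ p → Σ< (N ∸ p) (g p)) ≈ Σ< N (λ t → Σ< (suc t) (λ k → g (t ∸ k) k))
  Σ<-triangle zero    g = refl
  Σ<-triangle (suc N) g = begin
    Σ< (suc N) (λ p → Σ< (suc N ∸ p) (g p))
      ≈⟨ ∙-cong (Σ<-cong N (λ p p<N → reflexive (≡.cong (λ k → Σ< k (g p)) (ℕ.+-∸-assoc 1 (ℕ.<⇒≤ p<N)))))
                (reflexive (≡.cong (λ k → Σ< k (g N)) (ℕ.+-∸-assoc 1 (ℕ.≤-refl {N})))) ⟩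
    Σ< N (λ p → Σ< (N ∸ p) (g p) ∙ g p (N ∸ p)) ∙ Σ< (suc (N ∸ N)) (g N)
      ≈⟨ ∙-cong (Σ<-distrib N _ _) (reflexive (≡.cong (λ k → Σ< (suc k) (g N)) (ℕ.n∸n≡0 N))) ⟩
    (Σ< N (λ p → Σ< (N ∸ p) (g p)) ∙ Σ< N (λ p → g p (N ∸ p))) ∙ (ε ∙ g N 0)
      ≈⟨ trans (assoc _ _ _) (∙-cong (Σ<-triangle N g) (∙-cong refl (identityˡ _))) ⟩
    Σ< N (λ t → Σ< (suc t) (λ k → g (t ∸ k) k)) ∙ (Σ< N (λ p → g p (N ∸ p)) ∙ g N 0)
      ≈⟨ ∙-cong refl (trans (∙-cong refl (reflexive (≡.cong (g N) (≡.sym (ℕ.n∸n≡0 N))))) (Σ<-reverse (suc N) _)) ⟩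
    Σ< N (λ t → Σ< (suc t) (λ k → g (t ∸ k) k)) ∙ Σ< (suc N) (λ k → g (N ∸ k) (N ∸ (N ∸ k)))
      ≈⟨ ∙-cong refl (Σ<-cong (suc N) (λ k k≤N → reflexive (≡.cong (g (N ∸ k)) (ℕ.m∸[m∸n]≡n (ℕ.≤-pred k≤N))))) ⟩
    Σ< (suc N) (λ t → Σ< (suc t) (λ k → g (t ∸ k) k)) ∎

  Σ<-transpose : ∀ N (F : ℕ → ℕ → A) →
    Σ< N (λ k → Σ< (N ∸ k) (F k)) ≈ Σ< N (λ d → Σ< (N ∸ d) (λ k → F k d))
  Σ<-transpose N F = begin
    Σ< N (λ k → Σ< (N ∸ k) (F k))                     ≈⟨ Σ<-triangle N F ⟩
    Σ< N (λ t → Σ< (suc t) (λ k → F (t ∸ k) k))       ≈⟨ Σ<-cong N (λ t _ → reverse-diagonal t) ⟩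
    Σ< N (λ t → Σ< (suc t) (λ k → F k (t ∸ k)))       ≈⟨ sym (Σ<-triangle N (λ d k → F k d)) ⟩
    Σ< N (λ d → Σ< (N ∸ d) (λ k → F k d))             ∎
    where
    reverse-diagonal : ∀ t → Σ< (suc t) (λ k → F (t ∸ k) k) ≈ Σ< (suc t) (λ k → F k (t ∸ k))
    reverse-diagonal t = trans (Σ<-reverse (suc t) _)
      (Σ<-cong (suc t) (λ k k≤t → reflexive (≡.cong (λ j → F j (t ∸ k)) (ℕ.m∸[m∸n]≡n (ℕ.≤-pred k≤t)))))

  Σ<-hom : (h : A → A) → (∀ {x y} → x ≈ y → h x ≈ h y) → h ε ≈ ε → (∀ x y → h (x ∙ y) ≈ h x ∙ h y) →
           ∀ n (f : ℕ → A) → h (Σ< n f) ≈ Σ< n (h ∘ f)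
  Σ<-hom h h-cong h-ε h-∙ zero    f = h-ε
  Σ<-hom h h-cong h-ε h-∙ (suc n) f = trans (h-∙ _ _) (∙-cong (Σ<-hom h h-cong h-ε h-∙ n f) refl)

  ΣL : {I : Set} → List I → (I → A) → A
  ΣL []      h = ε
  ΣL (i ∷ l) h = h i ∙ ΣL l h

  module _ {I : Set} where

    ΣL-++ : ∀ (l m : List I) h → ΣL (l ++ m) h ≈ ΣL l h ∙ ΣL m h
    ΣL-++ []      m h = sym (identityˡ _)
    ΣL-++ (i ∷ l) m h = trans (∙-cong refl (ΣL-++ l m h)) (sym (assoc _ _ _))

    ΣL-map : ∀ {J : Set} (g : J → I) (l : List J) h → ΣL (map g l) h ≡ ΣL l (h ∘ g)
    ΣL-map g []      h = ≡.refl
    ΣL-map g (j ∷ l) h = ≡.cong (h (g j) ∙_) (ΣL-map g l h)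

    ΣL-concatMap : ∀ {J : Set} (g : J → List I) (l : List J) h → ΣL (concatMap g l) h ≈ ΣL l (λ j → ΣL (g j) h)
    ΣL-concatMap g []      h = refl
    ΣL-concatMap g (j ∷ l) h = trans (ΣL-++ (g j) (concatMap g l) h) (∙-cong refl (ΣL-concatMap g l h))

    ΣL-congᴬ : ∀ {P : I → Set} {l : List I} {h h′ : I → A} → All P l → (∀ i → P i → h i ≈ h′ i) → ΣL l h ≈ ΣL l h′
    ΣL-congᴬ []         h≈h′ = refl
    ΣL-congᴬ (pi ∷ pl) h≈h′ = ∙-cong (h≈h′ _ pi) (ΣL-congᴬ pl h≈h′)

    ΣL-cong : ∀ (l : List I) {h h′ : I → A} → (∀ i → h i ≈ h′ i) → ΣL l h ≈ ΣL l h′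
    ΣL-cong []      h≈h′ = refl
    ΣL-cong (i ∷ l) h≈h′ = ∙-cong (h≈h′ i) (ΣL-cong l h≈h′)

    ΣL-zero : ∀ (l : List I) {h : I → A} → (∀ i → h i ≈ ε) → ΣL l h ≈ ε
    ΣL-zero []      h≈ε = refl
    ΣL-zero (i ∷ l) h≈ε = trans (∙-cong (h≈ε i) (ΣL-zero l h≈ε)) (identityˡ ε)

    ΣL-distrib : ∀ (l : List I) h h′ → ΣL l (λ i → h i ∙ h′ i) ≈ ΣL l h ∙ ΣL l h′
    ΣL-distrib []      h h′ = sym (identityˡ ε)
    ΣL-distrib (i ∷ l) h h′ = trans (∙-cong refl (ΣL-distrib l h h′)) (interchange _ _ _ _)

    ΣL-hom : (f : A → A) → (∀ {x y} → x ≈ y → f x ≈ f y) → f ε ≈ ε → (∀ x y → f (x ∙ y) ≈ f x ∙ f y) →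
             ∀ (l : List I) h → f (ΣL l h) ≈ ΣL l (f ∘ h)
    ΣL-hom f f-cong f-ε f-∙ []      h = f-ε
    ΣL-hom f f-cong f-ε f-∙ (i ∷ l) h = trans (f-∙ _ _) (∙-cong refl (ΣL-hom f f-cong f-ε f-∙ l h))

open import Defs
open import Data.Bool using (Bool; true; false; if_then_else_; T)
open import Data.Empty using (⊥-elim)
open import Data.Integer as ℤ using (ℤ; -[1+_])
import Data.Integer.Properties as ℤ
import Data.Integer.Tactic.RingSolver as ℤ-Solver
import Data.List.Properties as List
import Data.List.Relation.Unary.All.Properties as All
open import Data.Nat.Tactic.RingSolver using (solve-∀)
open import Data.Product using (_×_; _,_; proj₁; proj₂)
open import Data.Rational as ℚ using (ℚ; 0ℚ; 1ℚ)
import Data.Rational.Properties as ℚ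
open import Algebra.Properties.CommutativeSemigroup (CommutativeMonoid.commutativeSemigroup ℚ.+-0-commutativeMonoid) using (x∙yz≈y∙xz)
open import Algebra.Properties.Ring ℚ.+-*-ring using (-1*x≈-x)
open import Level using (0ℓ)
open import Relation.Binary.Bundles using (Setoid)
import Relation.Binary.Reasoning.Setoid
open import Relation.Binary.Structures using (IsEquivalence)
open import Relation.Nullary using (¬_)
open import Relation.Nullary.Decidable using (Dec; yes; no; does; dec-true; dec-false)
open ≡

module Q = CommutativeMonoidSums ℚ.+-0-commutativeMonoid

-- ℚ's arithmetic is opened only inside this module, so that _+_, -_ and +_ mean ℤ's further down.
module _ where

  open import Data.Rational using (_+_; _*_; -_)

  when : Bool → ℚ → ℚ
  when b q = if b then q else 0ℚ

  when-0 : ∀ b → when b 0ℚ ≡ 0ℚ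
  when-0 true  = refl
  when-0 false = refl

  when-+ : ∀ b p q → when b p + when b q ≡ when b (p + q)
  when-+ true  p q = refl
  when-+ false p q = ℚ.+-identityˡ 0ℚ

  when-* : ∀ b a q → when b (a * q) ≡ a * when b q
  when-* true  a q = refl
  when-* false a q = sym (ℚ.*-zeroʳ a)

  coeff-∷ : ∀ c w x γ → coeff ((c , w) ∷ x) γ ≡ when (does (normalise w ≟w γ)) c + coeff x γ
  coeff-∷ c w x γ with does (normalise w ≟w γ)
  ... | true  = refl
  ... | false = sym (ℚ.+-identityˡ _)

  coeff-⊕ : ∀ x y γ → coeff (x ⊕ y) γ ≡ coeff x γ + coeff y γ
  coeff-⊕ []            y γ = sym (ℚ.+-identityˡ _)
  coeff-⊕ ((c , w) ∷ x) y γ = begin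
    coeff ((c , w) ∷ (x ++ y)) γ                ≡⟨ coeff-∷ c w (x ++ y) γ ⟩
    when b c + coeff (x ++ y) γ                 ≡⟨ cong (when b c +_) (coeff-⊕ x y γ) ⟩
    when b c + (coeff x γ + coeff y γ)          ≡⟨ sym (ℚ.+-assoc (when b c) _ _) ⟩
    (when b c + coeff x γ) + coeff y γ          ≡⟨ cong (_+ coeff y γ) (sym (coeff-∷ c w x γ)) ⟩
    coeff ((c , w) ∷ x) γ + coeff y γ           ∎
    where
    open ≡-Reasoning
    b = does (normalise w ≟w γ)

  coeff-scale : ∀ a x γ → coeff (scale a x) γ ≡ a * coeff x γ
  coeff-scale a []            γ = sym (ℚ.*-zeroʳ a)
  coeff-scale a ((c , w) ∷ x) γ = begin
    coeff ((a * c , w) ∷ scale a x) γ           ≡⟨ coeff-∷ (a * c) w (scale a x) γ ⟩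
    when b (a * c) + coeff (scale a x) γ        ≡⟨ cong₂ _+_ (when-* b a c) (coeff-scale a x γ) ⟩
    a * when b c + a * coeff x γ                ≡⟨ sym (ℚ.*-distribˡ-+ a (when b c) (coeff x γ)) ⟩
    a * (when b c + coeff x γ)                  ≡⟨ cong (a *_) (sym (coeff-∷ c w x γ)) ⟩
    a * coeff ((c , w) ∷ x) γ                   ∎
    where
    open ≡-Reasoning
    b = does (normalise w ≟w γ)

  -- A record around _≈_, so that both of its arguments can be inferred.
  infix 4 _≋_
  record _≋_ (x y : NSym) : Set where
    constructor coeffwise
    field coeff-≡ : x ≈ y
  open _≋_ public

  ≋-isEquivalence : IsEquivalence _≋_
  ≋-isEquivalence = record
    { refl  = coeffwise (λ γ → refl)
    ; sym   = λ (coeffwise p) → coeffwise (λ γ → sym (p γ))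
    ; trans = λ (coeffwise p) (coeffwise q) → coeffwise (λ γ → trans (p γ) (q γ))
    }

  ≋-setoid : Setoid 0ℓ 0ℓ
  ≋-setoid = record { isEquivalence = ≋-isEquivalence }

  open Setoid ≋-setoid public using () renaming (refl to ≋-refl; sym to ≋-sym; trans to ≋-trans; reflexive to ≡⇒≋)
  module ≋-Reasoning = Relation.Binary.Reasoning.Setoid ≋-setoid

  ⊕-cong : ∀ {x x′ y y′} → x ≋ x′ → y ≋ y′ → x ⊕ y ≋ x′ ⊕ y′
  ⊕-cong {x} {x′} {y} {y′} (coeffwise p) (coeffwise q) = coeffwise λ γ →
    trans (coeff-⊕ x y γ) (trans (cong₂ _+_ (p γ) (q γ)) (sym (coeff-⊕ x′ y′ γ)))

  ⊕-comm : ∀ x y → x ⊕ y ≋ y ⊕ x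
  ⊕-comm x y = coeffwise λ γ →
    trans (coeff-⊕ x y γ) (trans (ℚ.+-comm (coeff x γ) (coeff y γ)) (sym (coeff-⊕ y x γ)))

  NSym-commutativeMonoid : CommutativeMonoid 0ℓ 0ℓ
  NSym-commutativeMonoid = record
    { Carrier = NSym
    ; _≈_ = _≋_
    ; _∙_ = _⊕_
    ; ε = 0N
    ; isCommutativeMonoid = record
      { isMonoid = record
        { isSemigroup = record
          { isMagma = record { isEquivalence = ≋-isEquivalence ; ∙-cong = ⊕-cong }
          ; assoc = λ x y z → ≡⇒≋ (List.++-assoc x y z)
          }
        ; identity = (λ x → ≋-refl) , (λ x → ≡⇒≋ (List.++-identityʳ x))
        }
      ; comm = ⊕-comm
      }
    }

  module N = CommutativeMonoidSums NSym-commutativeMonoid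
  open CommutativeMonoid NSym-commutativeMonoid public using () renaming (identityʳ to ⊕-identityʳ)

  scale-cong : ∀ a {x y} → x ≋ y → scale a x ≋ scale a y
  scale-cong a {x} {y} (coeffwise p) = coeffwise λ γ →
    trans (coeff-scale a x γ) (trans (cong (a *_) (p γ)) (sym (coeff-scale a y γ)))

  scale-scale : ∀ a b x → scale a (scale b x) ≋ scale (a * b) x
  scale-scale a b x = coeffwise λ γ → begin
    coeff (scale a (scale b x)) γ   ≡⟨ coeff-scale a (scale b x) γ ⟩
    a * coeff (scale b x) γ         ≡⟨ cong (a *_) (coeff-scale b x γ) ⟩
    a * (b * coeff x γ)             ≡⟨ sym (ℚ.*-assoc a b (coeff x γ)) ⟩
    (a * b) * coeff x γ             ≡⟨ sym (coeff-scale (a * b) x γ) ⟩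
    coeff (scale (a * b) x) γ       ∎
    where open ≡-Reasoning

  scale-1 : ∀ x → scale 1ℚ x ≋ x
  scale-1 x = coeffwise λ γ → trans (coeff-scale 1ℚ x γ) (ℚ.*-identityˡ (coeff x γ))

  scale-0 : ∀ x → scale 0ℚ x ≋ 0N
  scale-0 x = coeffwise λ γ → trans (coeff-scale 0ℚ x γ) (ℚ.*-zeroˡ (coeff x γ))

  ⊕-⊖-transpose : ∀ {a b c} → a ⊕ b ≋ c → a ≋ c ⊖ b
  ⊕-⊖-transpose {a} {b} {c} (coeffwise p) = coeffwise λ γ → begin
    coeff a γ                                      ≡⟨ sym (ℚ.+-identityʳ (coeff a γ)) ⟩
    coeff a γ + 0ℚ                                 ≡⟨ cong (coeff a γ +_) (sym (ℚ.+-inverseʳ (coeff b γ))) ⟩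
    coeff a γ + (coeff b γ + - coeff b γ)          ≡⟨ sym (ℚ.+-assoc (coeff a γ) _ _) ⟩
    (coeff a γ + coeff b γ) + - coeff b γ          ≡⟨ cong₂ _+_ (trans (sym (coeff-⊕ a b γ)) (p γ)) (sym (-1*x≈-x _)) ⟩
    coeff c γ + - 1ℚ * coeff b γ                   ≡⟨ cong (coeff c γ +_) (sym (coeff-scale (- 1ℚ) b γ)) ⟩
    coeff c γ + coeff (⊖ b) γ                      ≡⟨ sym (coeff-⊕ c (⊖ b) γ) ⟩
    coeff (c ⊖ b) γ                                ∎
    where open ≡-Reasoning

  *-ΣL : ∀ {I : Set} a (l : List I) h → a * Q.ΣL l h ≡ Q.ΣL l (λ i → a * h i)
  *-ΣL a = Q.ΣL-hom (a *_) (cong (a *_)) (ℚ.*-zeroʳ a) (ℚ.*-distribˡ-+ a)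

  when-ΣL : ∀ {I : Set} b (l : List I) h → when b (Q.ΣL l h) ≡ Q.ΣL l (λ i → when b (h i))
  when-ΣL b = Q.ΣL-hom (when b) (cong (when b)) (when-0 b) (λ p q → sym (when-+ b p q))

  when-Σ< : ∀ b n f → when b (Q.Σ< n f) ≡ Q.Σ< n (λ i → when b (f i))
  when-Σ< b = Q.Σ<-hom (when b) (cong (when b)) (when-0 b) (λ p q → sym (when-+ b p q))

  coeff-Σ< : ∀ n f γ → coeff (N.Σ< n f) γ ≡ Q.Σ< n (λ i → coeff (f i) γ)
  coeff-Σ< zero    f γ = refl
  coeff-Σ< (suc n) f γ = trans (coeff-⊕ (N.Σ< n f) (f n) γ) (cong (_+ coeff (f n) γ) (coeff-Σ< n f γ))

  ⊖-inverseˡ : ∀ x → (⊖ x) ⊕ x ≋ 0N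
  ⊖-inverseˡ x = coeffwise λ γ → begin
    coeff ((⊖ x) ⊕ x) γ                ≡⟨ coeff-⊕ (⊖ x) x γ ⟩
    coeff (⊖ x) γ + coeff x γ          ≡⟨ cong (_+ coeff x γ) (trans (coeff-scale (- 1ℚ) x γ) (-1*x≈-x (coeff x γ))) ⟩
    - coeff x γ + coeff x γ            ≡⟨ ℚ.+-inverseˡ (coeff x γ) ⟩
    0ℚ                                 ∎
    where open ≡-Reasoning

  data Normal : Word → Set where
    []  : Normal []
    _∷_ : ∀ {w} a → Normal w → Normal (suc a ∷ w)

  normalise-Normal : ∀ w → Normal (normalise w)
  normalise-Normal []          = []
  normalise-Normal (zero ∷ w)  = normalise-Normal w
  normalise-Normal (suc a ∷ w) = a ∷ normalise-Normal w

  Normal⇒normalise≡ : ∀ {w} → Normal w → normalise w ≡ w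
  Normal⇒normalise≡ []      = refl
  Normal⇒normalise≡ (a ∷ n) = cong (suc a ∷_) (Normal⇒normalise≡ n)

  normal? : ∀ w → Dec (Normal w)
  normal? []          = yes []
  normal? (zero ∷ w)  = no λ ()
  normal? (suc a ∷ w) with normal? w
  ... | yes n = yes (a ∷ n)
  ... | no ¬n = no λ { (_ ∷ n) → ¬n n }

  [_≟_]  : Word → Word → ℚ → ℚ
  [ u ≟ v ] = when (does (u ≟w v))

  [≟]-≢ : ∀ {u v} c → ¬ u ≡ v → [ u ≟ v ] c ≡ 0ℚ
  [≟]-≢ {u} {v} c u≢v = cong (λ b → when b c) (dec-false (u ≟w v) u≢v)

  [≟]-∷ : ∀ a b u v c → [ a ∷ u ≟ b ∷ v ] c ≡ when (does (a ℕ.≟ b)) ([ u ≟ v ] c)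
  [≟]-∷ a b u v c with does (a ℕ.≟ b)
  ... | true  = refl
  ... | false = refl

  coeff-abnormal : ∀ x {γ} → ¬ Normal γ → coeff x γ ≡ 0ℚ
  coeff-abnormal []            ¬n = refl
  coeff-abnormal ((c , w) ∷ x) {γ} ¬n = begin
    coeff ((c , w) ∷ x) γ
      ≡⟨ coeff-∷ c w x γ ⟩
    [ normalise w ≟ γ ] c + coeff x γ
      ≡⟨ cong₂ _+_ ([≟]-≢ c λ eq → ¬n (subst Normal eq (normalise-Normal w))) (coeff-abnormal x ¬n) ⟩
    0ℚ + 0ℚ
      ≡⟨ ℚ.+-identityˡ 0ℚ ⟩
    0ℚ                                      ∎
    where open ≡-Reasoning

  ≋-on-Normal : ∀ {x y} → (∀ γ → Normal γ → coeff x γ ≡ coeff y γ) → x ≋ y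
  ≋-on-Normal {x} {y} eq = coeffwise λ γ → case γ (normal? γ)
    where
    case : ∀ γ → Dec (Normal γ) → coeff x γ ≡ coeff y γ
    case γ (yes n) = eq γ n
    case γ (no ¬n) = trans (coeff-abnormal x ¬n) (sym (coeff-abnormal y ¬n))

  coeff-ΣL : ∀ x γ → coeff x γ ≡ Q.ΣL x (λ (c , w) → [ normalise w ≟ γ ] c)
  coeff-ΣL []            γ = refl
  coeff-ΣL ((c , w) ∷ x) γ = trans (coeff-∷ c w x γ) (cong ([ normalise w ≟ γ ] c +_) (coeff-ΣL x γ))

  Comp : ℕ → Word → Set
  Comp n w = Normal w × size w ≡ n

  extendComp : Word → List Word
  extendComp []      = (1 ∷ []) ∷ []
  extendComp (a ∷ w) = (1 ∷ a ∷ w) ∷ (suc a ∷ w) ∷ []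

  comps-suc : ∀ n → comps (suc n) ≡ concatMap extendComp (comps n)
  comps-suc n = cong concat (List.map-cong (λ { [] → refl ; (_ ∷ _) → refl }) (comps n))

  comps-Comp : ∀ n → All (Comp n) (comps n)
  comps-Comp zero    = ([] , refl) ∷ []
  comps-Comp (suc n) rewrite comps-suc n = All.concat⁺ (All.map⁺ (All.map extend (comps-Comp n)))
    where
    extend : ∀ {w} → Comp n w → All (Comp (suc n)) (extendComp w)
    extend {[]}        (_ , e)       = (0 ∷ [] , cong suc e) ∷ []
    extend {suc a ∷ w} (_ ∷ nw , e) = (0 ∷ a ∷ nw , cong suc e) ∷ (suc a ∷ nw , cong suc e) ∷ []

  count-comps : ∀ n γ → Normal γ → Q.ΣL (comps n) (λ w → [ w ≟ γ ] 1ℚ) ≡ when (does (size γ ℕ.≟ n)) 1ℚ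
  count-comps zero    []      []      = refl
  count-comps zero    (_ ∷ _) (_ ∷ _) = refl
  count-comps (suc n) γ       nγ rewrite comps-suc n =
    trans (Q.ΣL-concatMap extendComp (comps n) _) (by-first-part γ nγ)
    where
    count : Word → Word → ℚ
    count γ w = Q.ΣL (extendComp w) (λ v → [ v ≟ γ ] 1ℚ)
    by-first-part : ∀ γ → Normal γ → Q.ΣL (comps n) (count γ) ≡ when (does (size γ ℕ.≟ suc n)) 1ℚ
    by-first-part [] [] = Q.ΣL-zero (comps n) λ { [] → refl ; (_ ∷ _) → refl }
    by-first-part (1 ∷ γ) (0 ∷ nγ) =
      trans (Q.ΣL-congᴬ (comps-Comp n) count≡) (count-comps n γ nγ)
      where
      count≡ : ∀ w → Comp n w → count (1 ∷ γ) w ≡ [ w ≟ γ ] 1ℚ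
      count≡ []          _ = trans (ℚ.+-identityʳ _) ([≟]-∷ 1 1 [] γ 1ℚ)
      count≡ (suc a ∷ w) _ = begin
        [ 1 ∷ suc a ∷ w ≟ 1 ∷ γ ] 1ℚ + ([ suc (suc a) ∷ w ≟ 1 ∷ γ ] 1ℚ + 0ℚ)
          ≡⟨ cong₂ _+_ ([≟]-∷ 1 1 (suc a ∷ w) γ 1ℚ) (trans (ℚ.+-identityʳ _) ([≟]-∷ (suc (suc a)) 1 w γ 1ℚ)) ⟩
        [ suc a ∷ w ≟ γ ] 1ℚ + 0ℚ  ≡⟨ ℚ.+-identityʳ _ ⟩
        [ suc a ∷ w ≟ γ ] 1ℚ       ∎
        where open ≡-Reasoning
    by-first-part (suc (suc b) ∷ γ) (suc b ∷ nγ) =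
      trans (Q.ΣL-congᴬ (comps-Comp n) count≡) (count-comps n (suc b ∷ γ) (b ∷ nγ))
      where
      count≡ : ∀ w → Comp n w → count (suc (suc b) ∷ γ) w ≡ [ w ≟ suc b ∷ γ ] 1ℚ
      count≡ []          _ = trans (ℚ.+-identityʳ _) ([≟]-∷ 1 (suc (suc b)) [] γ 1ℚ)
      count≡ (suc a ∷ w) _ = begin
        [ 1 ∷ suc a ∷ w ≟ suc (suc b) ∷ γ ] 1ℚ + ([ suc (suc a) ∷ w ≟ suc (suc b) ∷ γ ] 1ℚ + 0ℚ)
          ≡⟨ cong₂ _+_ ([≟]-∷ 1 (suc (suc b)) (suc a ∷ w) γ 1ℚ) (trans (ℚ.+-identityʳ _) ([≟]-∷ (suc (suc a)) (suc (suc b)) w γ 1ℚ)) ⟩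
        0ℚ + when (does (suc a ℕ.≟ suc b)) ([ w ≟ γ ] 1ℚ)   ≡⟨ ℚ.+-identityˡ _ ⟩
        when (does (suc a ℕ.≟ suc b)) ([ w ≟ γ ] 1ℚ)        ≡⟨ sym ([≟]-∷ (suc a) (suc b) w γ 1ℚ) ⟩
        [ suc a ∷ w ≟ suc b ∷ γ ] 1ℚ                       ∎
        where open ≡-Reasoning

  M : Word → QSym
  M γ = (1ℚ , γ) ∷ []

  Homogeneous : ℕ → QSym → Set
  Homogeneous k f = All (λ (_ , δ) → size δ ≡ k) f

  size-++ : ∀ u v → size (u ++ v) ≡ size u ℕ.+ size v
  size-++ []      v = refl
  size-++ (a ∷ u) v = trans (cong (a ℕ.+_) (size-++ u v)) (sym (ℕ.+-assoc a (size u) (size v)))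

  qsh-size : ∀ δ γ → All (λ ρ → size ρ ≡ size δ ℕ.+ size γ) (qsh δ γ)
  qsh-size []      γ       = refl ∷ []
  qsh-size (a ∷ α) []      = sym (ℕ.+-identityʳ _) ∷ []
  qsh-size (a ∷ α) (b ∷ β) =
    All.++⁺ (All.map⁺ (All.map (λ e → trans (cong (a ℕ.+_) e) (left a (size α) b (size β))) (qsh-size α (b ∷ β))))
    (All.++⁺ (All.map⁺ (All.map (λ e → trans (cong (b ℕ.+_) e) (right a (size α) b (size β))) (qsh-size (a ∷ α) β)))
             (All.map⁺ (All.map (λ e → trans (cong (a ℕ.+ b ℕ.+_) e) (both a (size α) b (size β))) (qsh-size α β))))
    where
    left : ∀ a s b t → a ℕ.+ (s ℕ.+ (b ℕ.+ t)) ≡ (a ℕ.+ s) ℕ.+ (b ℕ.+ t)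
    left = solve-∀
    right : ∀ a s b t → b ℕ.+ ((a ℕ.+ s) ℕ.+ t) ≡ (a ℕ.+ s) ℕ.+ (b ℕ.+ t)
    right = solve-∀
    both : ∀ a s b t → (a ℕ.+ b) ℕ.+ (s ℕ.+ t) ≡ (a ℕ.+ s) ℕ.+ (b ℕ.+ t)
    both = solve-∀

  refinements-size : ∀ α → All (λ w → size w ≡ size α) (refinements α)
  refinements-size []      = refl ∷ []
  refinements-size (a ∷ α) = All.concat⁺ (All.map⁺ (All.map refine (comps-Comp a)))
    where
    refine : ∀ {c} → Comp a c → All (λ w → size w ≡ size (a ∷ α)) (map (c ++_) (refinements α))
    refine {c} (_ , e) = All.map⁺ (All.map (λ {r} e′ → trans (size-++ c r) (cong₂ ℕ._+_ e e′)) (refinements-size α))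

  Fq-Homogeneous : ∀ α → Homogeneous (size α) (Fq α)
  Fq-Homogeneous α = All.map⁺ (refinements-size α)

  ·Q-M-Homogeneous : ∀ {k} f γ → Homogeneous k f → Homogeneous (k ℕ.+ size γ) (f ·Q M γ)
  ·Q-M-Homogeneous []            γ []         = []
  ·Q-M-Homogeneous ((c , δ) ∷ f) γ (e ∷ hf) =
    All.++⁺ (All.++⁺ (All.map⁺ (All.map (λ e′ → trans e′ (cong (ℕ._+ size γ) e)) (qsh-size δ γ))) [])
            (·Q-M-Homogeneous f γ hf)

  pairH-ΣL : ∀ β g → pairH β g ≡ Q.ΣL g (λ (c , δ) → [ δ ≟ β ] c)
  pairH-ΣL β []            = refl
  pairH-ΣL β ((c , δ) ∷ g) with does (δ ≟w β)
  ... | true  = cong (c +_) (pairH-ΣL β g)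
  ... | false = trans (pairH-ΣL β g) (sym (ℚ.+-identityˡ _))

  pairH-Homogeneous : ∀ {k} β g → Homogeneous k g → ¬ k ≡ size β → pairH β g ≡ 0ℚ
  pairH-Homogeneous β g hg k≢|β| = trans (pairH-ΣL β g) (trans (Q.ΣL-congᴬ hg vanish) (Q.ΣL-zero g (λ _ → refl)))
    where
    vanish : ∀ (p : ℚ × Word) → size (proj₂ p) ≡ _ → [ proj₂ p ≟ β ] (proj₁ p) ≡ 0ℚ
    vanish (c , δ) e = [≟]-≢ {δ} {β} c λ δ≡β → k≢|β| (trans (sym e) (cong size δ≡β))

  perpTerm : ℕ → QSym → ℚ → Word → NSym
  perpTerm k f c β = if k ≤ᵇ size β
    then map (λ γ → (c * pairH β (f ·Q M γ) , γ)) (comps (size β ∸ k))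
    else []

  coeff-map-comps : ∀ n (φ : Word → ℚ) γ → Normal γ →
    coeff (map (λ γ′ → (φ γ′ , γ′)) (comps n)) γ ≡ when (does (size γ ℕ.≟ n)) (φ γ)
  coeff-map-comps n φ γ nγ = begin
    coeff (map tag (comps n)) γ                                     ≡⟨ coeff-ΣL (map tag (comps n)) γ ⟩
    Q.ΣL (map tag (comps n)) (λ (c , w) → [ normalise w ≟ γ ] c)    ≡⟨ Q.ΣL-map tag (comps n) _ ⟩
    Q.ΣL (comps n) (λ γ′ → [ normalise γ′ ≟ γ ] (φ γ′))             ≡⟨ Q.ΣL-congᴬ (comps-Comp n) pick ⟩
    Q.ΣL (comps n) (λ γ′ → φ γ * [ γ′ ≟ γ ] 1ℚ)                     ≡⟨ sym (*-ΣL (φ γ) (comps n) _) ⟩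
    φ γ * Q.ΣL (comps n) (λ γ′ → [ γ′ ≟ γ ] 1ℚ)                     ≡⟨ cong (φ γ *_) (count-comps n γ nγ) ⟩
    φ γ * when (does (size γ ℕ.≟ n)) 1ℚ                             ≡⟨ sym (when-* _ (φ γ) 1ℚ) ⟩
    when (does (size γ ℕ.≟ n)) (φ γ * 1ℚ)                           ≡⟨ cong (when _) (ℚ.*-identityʳ (φ γ)) ⟩
    when (does (size γ ℕ.≟ n)) (φ γ)                                ∎
    where
    open ≡-Reasoning
    tag : Word → ℚ × Word
    tag γ′ = (φ γ′ , γ′)
    pick : ∀ γ′ → Comp n γ′ → [ normalise γ′ ≟ γ ] (φ γ′) ≡ φ γ * [ γ′ ≟ γ ] 1ℚ
    pick γ′ (nγ′ , _) rewrite Normal⇒normalise≡ nγ′ with γ′ ≟w γ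
    ... | yes refl = sym (ℚ.*-identityʳ (φ γ′))
    ... | no _     = sym (ℚ.*-zeroʳ (φ γ))

  coeff-perpTerm : ∀ {k} f c β γ → Homogeneous k f → Normal γ →
    coeff (perpTerm k f c β) γ ≡ c * pairH β (f ·Q M γ)
  coeff-perpTerm {k} f c β γ hf nγ with k ≤ᵇ size β in k≤ᵇ|β|
  ... | false = vanishes λ e → subst T k≤ᵇ|β| (ℕ.≤⇒≤ᵇ (subst (k ℕ.≤_) e (ℕ.m≤m+n k (size γ))))
    where
    vanishes : ¬ k ℕ.+ size γ ≡ size β → 0ℚ ≡ c * pairH β (f ·Q M γ)
    vanishes ≢ = sym (trans (cong (c *_) (pairH-Homogeneous β _ (·Q-M-Homogeneous f γ hf) ≢)) (ℚ.*-zeroʳ c))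
  ... | true  = trans (coeff-map-comps (size β ∸ k) _ γ nγ) (by-size (size γ ℕ.≟ size β ∸ k))
    where
    by-size : Dec (size γ ≡ size β ∸ k) → when (does (size γ ℕ.≟ size β ∸ k)) (c * pairH β (f ·Q M γ)) ≡ c * pairH β (f ·Q M γ)
    by-size (yes e) rewrite dec-true (size γ ℕ.≟ size β ∸ k) e = refl
    by-size (no ¬e) rewrite dec-false (size γ ℕ.≟ size β ∸ k) ¬e =
      sym (trans (cong (c *_) (pairH-Homogeneous β _ (·Q-M-Homogeneous f γ hf) λ e → ¬e (sym (trans (cong (_∸ k) (sym e)) (ℕ.m+n∸m≡n k (size γ))))))
                 (ℚ.*-zeroʳ c))

  coeff-perpHom : ∀ {k} f x γ → Homogeneous k f → Normal γ →
    coeff (perpHom k f x) γ ≡ Q.ΣL (f ·Q M γ) (λ (e , ρ) → e * coeff x ρ)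
  coeff-perpHom f []            γ hf nγ = sym (Q.ΣL-zero (f ·Q M γ) (λ (e , _) → ℚ.*-zeroʳ e))
  coeff-perpHom {k} f ((c , w) ∷ x) γ hf nγ = begin
    coeff (perpTerm k f c β ⊕ perpHom k f x) γ
      ≡⟨ coeff-⊕ (perpTerm k f c β) (perpHom k f x) γ ⟩
    coeff (perpTerm k f c β) γ + coeff (perpHom k f x) γ
      ≡⟨ cong₂ _+_ (coeff-perpTerm f c β γ hf nγ) (coeff-perpHom f x γ hf nγ) ⟩
    c * pairH β g + Q.ΣL g (λ (e , ρ) → e * coeff x ρ)
      ≡⟨ cong (_+ _) pairing ⟩
    Q.ΣL g (λ (e , ρ) → e * [ β ≟ ρ ] c) + Q.ΣL g (λ (e , ρ) → e * coeff x ρ)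
      ≡⟨ sym (Q.ΣL-distrib g _ _) ⟩
    Q.ΣL g (λ (e , ρ) → e * [ β ≟ ρ ] c + e * coeff x ρ)
      ≡⟨ Q.ΣL-cong g (λ (e , ρ) → sym (trans (cong (e *_) (coeff-∷ c w x ρ)) (ℚ.*-distribˡ-+ e _ _))) ⟩
    Q.ΣL g (λ (e , ρ) → e * coeff ((c , w) ∷ x) ρ)                  ∎
    where
    open ≡-Reasoning
    β = normalise w
    g = f ·Q M γ
    swap : ∀ e ρ → c * [ ρ ≟ β ] e ≡ e * [ β ≟ ρ ] c
    swap e ρ with ρ ≟w β | β ≟w ρ
    ... | yes refl | yes _    = ℚ.*-comm c e
    ... | no _     | no _     = trans (ℚ.*-zeroʳ c) (sym (ℚ.*-zeroʳ e))
    ... | yes refl | no β≢β   = ⊥-elim (β≢β refl)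
    ... | no β≢β   | yes refl = ⊥-elim (β≢β refl)
    pairing : c * pairH β g ≡ Q.ΣL g (λ (e , ρ) → e * [ β ≟ ρ ] c)
    pairing = trans (cong (c *_) (pairH-ΣL β g)) (trans (*-ΣL c g _) (Q.ΣL-cong g (λ (e , ρ) → swap e ρ)))

  -- The coefficient of H_γ in M_δ^⊥ x, when φ = coeff x.
  M⊥-coeff : Word → (Word → ℚ) → Word → ℚ
  M⊥-coeff δ φ γ = Q.ΣL (qsh δ γ) φ

  coeff-Fperp : ∀ α x γ → Normal γ →
    coeff (Fperp α x) γ ≡ Q.ΣL (refinements α) (λ δ → M⊥-coeff δ (coeff x) γ)
  coeff-Fperp α x γ nγ = trans (coeff-perpHom (Fq α) x γ (Fq-Homogeneous α) nγ) (expand (refinements α))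
    where
    expand : ∀ L → Q.ΣL (map (λ β → (1ℚ , β)) L ·Q M γ) (λ (e , ρ) → e * coeff x ρ)
                 ≡ Q.ΣL L (λ δ → M⊥-coeff δ (coeff x) γ)
    expand []      = refl
    expand (δ ∷ L) = begin
      Q.ΣL ((map (λ ρ → (1ℚ * 1ℚ , ρ)) (qsh δ γ) ++ []) ++ rest) term
        ≡⟨ Q.ΣL-++ (map (λ ρ → (1ℚ * 1ℚ , ρ)) (qsh δ γ) ++ []) rest term ⟩
      Q.ΣL (map (λ ρ → (1ℚ * 1ℚ , ρ)) (qsh δ γ) ++ []) term + Q.ΣL rest term
        ≡⟨ cong₂ _+_ unit-coefficients (expand L) ⟩
      M⊥-coeff δ (coeff x) γ + Q.ΣL L (λ δ → M⊥-coeff δ (coeff x) γ) ∎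
      where
      open ≡-Reasoning
      rest = map (λ β → (1ℚ , β)) L ·Q M γ
      term : ℚ × Word → ℚ
      term (e , ρ) = e * coeff x ρ
      unit-coefficients : Q.ΣL (map (λ ρ → (1ℚ * 1ℚ , ρ)) (qsh δ γ) ++ []) term ≡ M⊥-coeff δ (coeff x) γ
      unit-coefficients = begin
        Q.ΣL (map (λ ρ → (1ℚ * 1ℚ , ρ)) (qsh δ γ) ++ []) term
          ≡⟨ cong (λ l → Q.ΣL l term) (List.++-identityʳ (map (λ ρ → (1ℚ * 1ℚ , ρ)) (qsh δ γ))) ⟩
        Q.ΣL (map (λ ρ → (1ℚ * 1ℚ , ρ)) (qsh δ γ)) term
          ≡⟨ Q.ΣL-map _ (qsh δ γ) term ⟩
        Q.ΣL (qsh δ γ) (λ ρ → (1ℚ * 1ℚ) * coeff x ρ)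
          ≡⟨ Q.ΣL-cong (qsh δ γ) (λ ρ → ℚ.*-identityˡ (coeff x ρ)) ⟩
        M⊥-coeff δ (coeff x) γ                                 ∎

  coeff-F⊥ : ∀ r x γ → Normal γ → coeff (F⊥ (ℤ.+ r) x) γ ≡ Q.ΣL (comps r) (λ δ → M⊥-coeff δ (coeff x) γ)
  coeff-F⊥ zero    x γ nγ = coeff-Fperp [] x γ nγ
  coeff-F⊥ (suc r) x γ nγ = trans (coeff-Fperp (suc r ∷ []) x γ nγ)
    (trans (Q.ΣL-concatMap (λ c → (c ++ []) ∷ []) (comps (suc r)) _)
           (Q.ΣL-cong (comps (suc r)) λ c → trans (ℚ.+-identityʳ _) (cong (λ u → M⊥-coeff u (coeff x) γ) (List.++-identityʳ c))))

  refinements-1ⁱ : ∀ i → refinements (replicate i 1) ≡ replicate i 1 ∷ []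
  refinements-1ⁱ zero = refl
  refinements-1ⁱ (suc i) rewrite refinements-1ⁱ i = refl

  coeff-F⊥1 : ∀ i x γ → Normal γ → coeff (F⊥1 i x) γ ≡ M⊥-coeff (replicate i 1) (coeff x) γ
  coeff-F⊥1 i x γ nγ = trans (coeff-Fperp (replicate i 1) x γ nγ)
    (trans (cong (λ L → Q.ΣL L (λ δ → M⊥-coeff δ (coeff x) γ)) (refinements-1ⁱ i)) (ℚ.+-identityʳ _))

  record IsLinear (T : Op) : Set where
    field
      ≋-cong    : ∀ {x y} → x ≋ y → T x ≋ T y
      ⊕-hom     : ∀ x y → T (x ⊕ y) ≋ T x ⊕ T y
      scale-hom : ∀ c x → T (scale c x) ≋ scale c (T x)

    0-hom : T 0N ≋ 0N
    0-hom = ≋-trans (≋-cong (≋-sym (scale-0 0N))) (≋-trans (scale-hom 0ℚ 0N) (scale-0 (T 0N)))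

    ≋0-hom : ∀ {x} → x ≋ 0N → T x ≋ 0N
    ≋0-hom x≋0 = ≋-trans (≋-cong x≋0) 0-hom

    ⊖-hom : ∀ x → T (⊖ x) ≋ ⊖ T x
    ⊖-hom = scale-hom (- 1ℚ)

    Σ<-hom : ∀ n f → T (N.Σ< n f) ≋ N.Σ< n (T ∘ f)
    Σ<-hom = N.Σ<-hom T ≋-cong 0-hom ⊕-hom

  open IsLinear public

  0-linear : IsLinear (λ _ → 0N)
  0-linear = record { ≋-cong = λ _ → ≋-refl ; ⊕-hom = λ _ _ → ≋-refl ; scale-hom = λ _ _ → ≋-refl }

  ∘-linear : ∀ {S T} → IsLinear S → IsLinear T → IsLinear (S ∘ T)
  ∘-linear {S} {T} LS LT = record
    { ≋-cong    = ≋-cong LS ∘ ≋-cong LT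
    ; ⊕-hom     = λ x y → ≋-trans (≋-cong LS (⊕-hom LT x y)) (⊕-hom LS (T x) (T y))
    ; scale-hom = λ c x → ≋-trans (≋-cong LS (scale-hom LT c x)) (scale-hom LS c (T x))
    }

  scale-linear : ∀ a → IsLinear (scale a)
  scale-linear a = record
    { ≋-cong    = scale-cong a
    ; ⊕-hom     = λ x y → ≡⇒≋ (List.map-++ _ x y)
    ; scale-hom = λ c x → ≋-trans (scale-scale a c x)
                            (≋-trans (≡⇒≋ (cong (λ q → scale q x) (ℚ.*-comm a c))) (≋-sym (scale-scale c a x)))
    }

  Σ<-linear : ∀ n (T : ℕ → Op) → (∀ i → IsLinear (T i)) → IsLinear (λ y → N.Σ< n (λ i → T i y))
  Σ<-linear n T LT = record
    { ≋-cong    = λ x≋y → N.Σ<-cong n (λ i _ → ≋-cong (LT i) x≋y)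
    ; ⊕-hom     = λ x y → ≋-trans (N.Σ<-cong n (λ i _ → ⊕-hom (LT i) x y)) (N.Σ<-distrib n _ _)
    ; scale-hom = λ c x → ≋-trans (N.Σ<-cong n (λ i _ → scale-hom (LT i) c x)) (≋-sym (Σ<-hom (scale-linear c) n _))
    }

  HL-coeff : ℤ → (Word → ℚ) → Word → ℚ
  HL-coeff (ℤ.+ zero)  φ γ       = φ γ
  HL-coeff (ℤ.+ suc n) φ []      = 0ℚ
  HL-coeff (ℤ.+ suc n) φ (g ∷ γ) = when (does (suc n ℕ.≟ g)) (φ γ)
  HL-coeff -[1+ _ ]    φ γ       = 0ℚ

  coeff-HL : ∀ b y γ → coeff (HL b y) γ ≡ HL-coeff b (coeff y) γ
  coeff-HL (ℤ.+ zero)  y             γ       = refl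
  coeff-HL -[1+ _ ]    y             γ       = refl
  coeff-HL (ℤ.+ suc n) []            []      = refl
  coeff-HL (ℤ.+ suc n) []            (g ∷ γ) = sym (when-0 (does (suc n ℕ.≟ g)))
  coeff-HL (ℤ.+ suc n) ((c , w) ∷ y) []      =
    trans (coeff-∷ c (suc n ∷ w) (HL (ℤ.+ suc n) y) []) (trans (ℚ.+-identityˡ _) (coeff-HL (ℤ.+ suc n) y []))
  coeff-HL (ℤ.+ suc n) ((c , w) ∷ y) (g ∷ γ) = begin
    coeff ((c , suc n ∷ w) ∷ HL (ℤ.+ suc n) y) (g ∷ γ)
      ≡⟨ coeff-∷ c (suc n ∷ w) (HL (ℤ.+ suc n) y) (g ∷ γ) ⟩
    [ suc n ∷ normalise w ≟ g ∷ γ ] c + coeff (HL (ℤ.+ suc n) y) (g ∷ γ)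
      ≡⟨ cong₂ _+_ ([≟]-∷ (suc n) g (normalise w) γ c) (coeff-HL (ℤ.+ suc n) y (g ∷ γ)) ⟩
    when b ([ normalise w ≟ γ ] c) + when b (coeff y γ)
      ≡⟨ when-+ b _ _ ⟩
    when b ([ normalise w ≟ γ ] c + coeff y γ)
      ≡⟨ cong (when b) (sym (coeff-∷ c w y γ)) ⟩
    when b (coeff ((c , w) ∷ y) γ)                               ∎
    where
    open ≡-Reasoning
    b = does (suc n ℕ.≟ g)

  HL-coeff-cong : ∀ b {φ ψ : Word → ℚ} → (∀ ρ → φ ρ ≡ ψ ρ) → ∀ γ → HL-coeff b φ γ ≡ HL-coeff b ψ γ
  HL-coeff-cong (ℤ.+ zero)  φ≗ψ γ       = φ≗ψ γ
  HL-coeff-cong (ℤ.+ suc n) φ≗ψ []      = refl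
  HL-coeff-cong (ℤ.+ suc n) φ≗ψ (g ∷ γ) = cong (when _) (φ≗ψ γ)
  HL-coeff-cong -[1+ _ ]    φ≗ψ γ       = refl

  HL-linear : ∀ b → IsLinear (HL b)
  HL-linear b = record
    { ≋-cong    = λ {x} {y} (coeffwise p) → coeffwise λ γ →
                    trans (coeff-HL b x γ) (trans (HL-coeff-cong b p γ) (sym (coeff-HL b y γ)))
    ; ⊕-hom     = ⊕-hom′ b
    ; scale-hom = scale-hom′ b
    }
    where
    ⊕-hom′ : ∀ b x y → HL b (x ⊕ y) ≋ HL b x ⊕ HL b y
    ⊕-hom′ (ℤ.+ zero)  x y = ≋-refl
    ⊕-hom′ (ℤ.+ suc n) x y = ≡⇒≋ (List.map-++ _ x y)
    ⊕-hom′ -[1+ _ ]    x y = ≋-refl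
    scale-hom′ : ∀ b c x → HL b (scale c x) ≋ scale c (HL b x)
    scale-hom′ (ℤ.+ zero)  c x = ≋-refl
    scale-hom′ (ℤ.+ suc n) c x = ≡⇒≋ (trans (sym (List.map-∘ x)) (List.map-∘ x))
    scale-hom′ -[1+ _ ]    c x = ≋-refl

  perpHom-linear : ∀ {k} f → Homogeneous k f → IsLinear (perpHom k f)
  perpHom-linear {k} f hf = record
    { ≋-cong    = λ {x} {y} (coeffwise p) → ≋-on-Normal λ γ nγ →
                    trans (coeff-perpHom f x γ hf nγ)
                   (trans (Q.ΣL-cong (f ·Q M γ) (λ (e , ρ) → cong (e *_) (p ρ)))
                          (sym (coeff-perpHom f y γ hf nγ)))
    ; ⊕-hom     = λ x y → ≡⇒≋ (List.concatMap-++ _ x y)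
    ; scale-hom = λ c x → ≋-on-Normal λ γ nγ → begin
        coeff (perpHom k f (scale c x)) γ                       ≡⟨ coeff-perpHom f (scale c x) γ hf nγ ⟩
        Q.ΣL (f ·Q M γ) (λ (e , ρ) → e * coeff (scale c x) ρ)   ≡⟨ Q.ΣL-cong (f ·Q M γ) (λ (e , ρ) → scaled {c} {x} e ρ) ⟩
        Q.ΣL (f ·Q M γ) (λ (e , ρ) → c * (e * coeff x ρ))       ≡⟨ sym (*-ΣL c (f ·Q M γ) _) ⟩
        c * Q.ΣL (f ·Q M γ) (λ (e , ρ) → e * coeff x ρ)         ≡⟨ cong (c *_) (sym (coeff-perpHom f x γ hf nγ)) ⟩
        c * coeff (perpHom k f x) γ                             ≡⟨ sym (coeff-scale c (perpHom k f x) γ) ⟩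
        coeff (scale c (perpHom k f x)) γ                       ∎
    }
    where
    open ≡-Reasoning
    scaled : ∀ {c x} e ρ → e * coeff (scale c x) ρ ≡ c * (e * coeff x ρ)
    scaled {c} {x} e ρ = begin
      e * coeff (scale c x) ρ   ≡⟨ cong (e *_) (coeff-scale c x ρ) ⟩
      e * (c * coeff x ρ)       ≡⟨ sym (ℚ.*-assoc e c _) ⟩
      (e * c) * coeff x ρ       ≡⟨ cong (_* coeff x ρ) (ℚ.*-comm e c) ⟩
      (c * e) * coeff x ρ       ≡⟨ ℚ.*-assoc c e _ ⟩
      c * (e * coeff x ρ)       ∎

  Fperp-linear : ∀ α → IsLinear (Fperp α)
  Fperp-linear α = perpHom-linear (Fq α) (Fq-Homogeneous α)

  F⊥-linear : ∀ r → IsLinear (F⊥ r)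
  F⊥-linear (ℤ.+ zero)  = Fperp-linear []
  F⊥-linear (ℤ.+ suc r) = Fperp-linear (suc r ∷ [])
  F⊥-linear -[1+ _ ]    = 0-linear

  F⊥1-linear : ∀ i → IsLinear (F⊥1 i)
  F⊥1-linear i = Fperp-linear (replicate i 1)

  F⊥-0 : ∀ x → F⊥ (ℤ.+ 0) x ≋ x
  F⊥-0 x = ≋-on-Normal λ γ nγ → trans (coeff-F⊥ 0 x γ nγ) (trans (ℚ.+-identityʳ _) (ℚ.+-identityʳ _))

  F⊥1-0 : ∀ x → F⊥1 0 x ≋ x
  F⊥1-0 x = ≋-on-Normal λ γ nγ → trans (coeff-F⊥1 0 x γ nγ) (ℚ.+-identityʳ _)

  H : Word → NSym
  H w = (1ℚ , w) ∷ []

  H-induction : (P : NSym → Set) → (∀ {x y} → x ≋ y → P x → P y) →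
    P (H []) → (∀ n y → P y → P (HL (ℤ.+ suc n) y)) → ∀ w → P (H w)
  H-induction P resp base step []          = base
  H-induction P resp base step (zero ∷ w)  = resp (coeffwise λ γ → refl) (H-induction P resp base step w)
  H-induction P resp base step (suc n ∷ w) = step n (H w) (H-induction P resp base step w)

  linear-ext : ∀ {S T} → IsLinear S → IsLinear T → (∀ w → S (H w) ≋ T (H w)) → ∀ x → S x ≋ T x
  linear-ext LS LT S≋T []            = ≋-trans (0-hom LS) (≋-sym (0-hom LT))
  linear-ext {S} {T} LS LT S≋T ((c , w) ∷ x) = begin
    S ((c , w) ∷ x)                     ≈⟨ ⊕-hom LS ((c , w) ∷ []) x ⟩
    S ((c , w) ∷ []) ⊕ S x              ≈⟨ ⊕-cong (≋-trans (≋-cong LS term) (scale-hom LS c (H w))) (linear-ext LS LT S≋T x) ⟩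
    scale c (S (H w)) ⊕ T x             ≈⟨ ⊕-cong (scale-cong c (S≋T w)) ≋-refl ⟩
    scale c (T (H w)) ⊕ T x             ≈⟨ ⊕-cong (≋-sym (≋-trans (≋-cong LT term) (scale-hom LT c (H w)))) ≋-refl ⟩
    T ((c , w) ∷ []) ⊕ T x              ≈⟨ ≋-sym (⊕-hom LT ((c , w) ∷ []) x) ⟩
    T ((c , w) ∷ x)                     ∎
    where
    open ≋-Reasoning
    term : (c , w) ∷ [] ≋ scale c (H w)
    term = ≡⇒≋ (cong (λ q → (q , w) ∷ []) (sym (ℚ.*-identityʳ c)))

  -- The Leibniz rules

  qsh-[] : ∀ δ → qsh δ [] ≡ δ ∷ []
  qsh-[] []      = refl
  qsh-[] (a ∷ δ) = refl

  comps-by-first-part : ∀ r (Φ : Word → ℚ) →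
    Q.ΣL (comps (suc r)) Φ ≡ Q.Σ< (suc r) (λ d → Q.ΣL (comps (r ∸ d)) (λ δ → Φ (suc d ∷ δ)))
  comps-by-first-part zero    Φ = sym (ℚ.+-identityˡ _)
  comps-by-first-part (suc r) Φ = begin
    Q.ΣL (comps (suc (suc r))) Φ
      ≡⟨ cong (λ L → Q.ΣL L Φ) (comps-suc (suc r)) ⟩
    Q.ΣL (concatMap extendComp (comps (suc r))) Φ
      ≡⟨ Q.ΣL-concatMap extendComp (comps (suc r)) Φ ⟩
    Q.ΣL (comps (suc r)) (λ w → Q.ΣL (extendComp w) Φ)
      ≡⟨ Q.ΣL-congᴬ (comps-Comp (suc r)) split ⟩
    Q.ΣL (comps (suc r)) (λ w → Φ (1 ∷ w) + Φ↑ w)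
      ≡⟨ Q.ΣL-distrib (comps (suc r)) _ _ ⟩
    Q.ΣL (comps (suc r)) (λ w → Φ (1 ∷ w)) + Q.ΣL (comps (suc r)) Φ↑
      ≡⟨ cong (Q.ΣL (comps (suc r)) (λ w → Φ (1 ∷ w)) +_) (comps-by-first-part r Φ↑) ⟩
    Q.ΣL (comps (suc r)) (λ w → Φ (1 ∷ w)) + Q.Σ< (suc r) (λ d → Q.ΣL (comps (r ∸ d)) (λ δ → Φ (suc (suc d) ∷ δ)))
      ≡⟨ sym (Q.Σ<-head (suc r) _) ⟩
    Q.Σ< (suc (suc r)) (λ d → Q.ΣL (comps (suc r ∸ d)) (λ δ → Φ (suc d ∷ δ))) ∎
    where
    open ≡-Reasoning
    Φ↑ : Word → ℚ
    Φ↑ []      = 0ℚ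
    Φ↑ (a ∷ w) = Φ (suc a ∷ w)
    split : ∀ w → Comp (suc r) w → Q.ΣL (extendComp w) Φ ≡ Φ (1 ∷ w) + Φ↑ w
    split (a ∷ w) _ = cong (Φ (1 ∷ a ∷ w) +_) (ℚ.+-identityʳ _)

  HL-coeff-⊖-[] : ∀ n d ψ → HL-coeff (suc n ℤ.⊖ suc d) ψ [] ≡ when (does (n ℕ.≟ d)) (ψ [])
  HL-coeff-⊖-[] zero    zero    ψ = refl
  HL-coeff-⊖-[] zero    (suc d) ψ = refl
  HL-coeff-⊖-[] (suc n) zero    ψ = refl
  HL-coeff-⊖-[] (suc n) (suc d) ψ =
    trans (cong (λ b → HL-coeff b ψ []) (ℤ.[1+m]⊖[1+n]≡m⊖n (suc n) (suc d))) (HL-coeff-⊖-[] n d ψ)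

  HL-coeff-⊖-∷ : ∀ n d g ψ γ → HL-coeff (suc n ℤ.⊖ suc d) ψ (suc g ∷ γ)
                   ≡ when (does (n ℕ.≟ d)) (ψ (suc g ∷ γ)) + when (does (suc n ℕ.≟ suc d ℕ.+ suc g)) (ψ γ)
  HL-coeff-⊖-∷ zero    zero    g ψ γ = sym (ℚ.+-identityʳ _)
  HL-coeff-⊖-∷ zero    (suc d) g ψ γ = sym (ℚ.+-identityˡ 0ℚ)
  HL-coeff-⊖-∷ (suc n) zero    g ψ γ = sym (ℚ.+-identityˡ _)
  HL-coeff-⊖-∷ (suc n) (suc d) g ψ γ =
    trans (cong (λ b → HL-coeff b ψ (suc g ∷ γ)) (ℤ.[1+m]⊖[1+n]≡m⊖n (suc n) (suc d))) (HL-coeff-⊖-∷ n d g ψ γ)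

  coeff-F⊥-suc : ∀ r x γ → Normal γ →
    coeff (F⊥ (ℤ.+ suc r) x) γ ≡ Q.Σ< (suc r) (λ d → Q.ΣL (comps (r ∸ d)) (λ δ → M⊥-coeff (suc d ∷ δ) (coeff x) γ))
  coeff-F⊥-suc r x γ nγ = trans (coeff-F⊥ (suc r) x γ nγ) (comps-by-first-part r _)

  -- Expanding M_{(x,δ)}^⊥ (H_a y) by the first letter of the quasi-shuffles of (x,δ) with (g,γ).
  M⊥-coeff-HL-∷ : ∀ n φ x δ g γ →
    M⊥-coeff (x ∷ δ) (HL-coeff (ℤ.+ suc n) φ) (g ∷ γ)
    ≡ when (does (suc n ℕ.≟ x)) (M⊥-coeff δ φ (g ∷ γ))
      + (when (does (suc n ℕ.≟ g)) (M⊥-coeff (x ∷ δ) φ γ) + when (does (suc n ℕ.≟ x ℕ.+ g)) (M⊥-coeff δ φ γ))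
  M⊥-coeff-HL-∷ n φ x δ g γ = begin
    Q.ΣL (L₁ ++ L₂ ++ L₃) hc
      ≡⟨ Q.ΣL-++ L₁ (L₂ ++ L₃) hc ⟩
    Q.ΣL L₁ hc + Q.ΣL (L₂ ++ L₃) hc
      ≡⟨ cong (Q.ΣL L₁ hc +_) (Q.ΣL-++ L₂ L₃ hc) ⟩
    Q.ΣL L₁ hc + (Q.ΣL L₂ hc + Q.ΣL L₃ hc)
      ≡⟨ cong₂ _+_ (prefixed x (qsh δ (g ∷ γ))) (cong₂ _+_ (prefixed g (qsh (x ∷ δ) γ)) (prefixed (x ℕ.+ g) (qsh δ γ))) ⟩
    _                                                 ∎
    where
    open ≡-Reasoning
    hc = HL-coeff (ℤ.+ suc n) φ
    L₁ = map (x ∷_) (qsh δ (g ∷ γ))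
    L₂ = map (g ∷_) (qsh (x ∷ δ) γ)
    L₃ = map (x ℕ.+ g ∷_) (qsh δ γ)
    prefixed : ∀ z L → Q.ΣL (map (z ∷_) L) hc ≡ when (does (suc n ℕ.≟ z)) (Q.ΣL L φ)
    prefixed z L = trans (Q.ΣL-map (z ∷_) L hc) (sym (when-ΣL (does (suc n ℕ.≟ z)) L φ))

  F⊥-HL-suc : ∀ n r y →
    F⊥ (ℤ.+ suc r) (HL (ℤ.+ suc n) y)
    ≋ HL (ℤ.+ suc n) (F⊥ (ℤ.+ suc r) y) ⊕ N.Σ< (suc r) (λ d → HL (suc n ℤ.⊖ suc d) (F⊥ (ℤ.+ (r ∸ d)) y))
  F⊥-HL-suc n r y = ≋-on-Normal λ γ nγ → trans (lhs γ nγ) (trans (by-γ γ nγ) (sym (rhs γ)))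
    where
    a = ℤ.+ suc n
    φ = coeff y
    ψ : ℕ → Word → ℚ
    ψ d = coeff (F⊥ (ℤ.+ (r ∸ d)) y)
    C : ℕ → List Word
    C d = comps (r ∸ d)
    byFirstPart : ℕ → Word → ℚ
    byFirstPart d γ = Q.ΣL (C d) (λ δ → M⊥-coeff (suc d ∷ δ) (HL-coeff a φ) γ)
    G : ℕ → NSym
    G d = HL (suc n ℤ.⊖ suc d) (F⊥ (ℤ.+ (r ∸ d)) y)
    shiftedTerm : ℕ → Word → ℚ
    shiftedTerm d γ = HL-coeff (suc n ℤ.⊖ suc d) (ψ d) γ

    ψ-sum : ∀ d γ → Normal γ → ψ d γ ≡ Q.ΣL (C d) (λ δ → M⊥-coeff δ φ γ)
    ψ-sum d = coeff-F⊥ (r ∸ d) y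

    lhs : ∀ γ → Normal γ → coeff (F⊥ (ℤ.+ suc r) (HL a y)) γ ≡ Q.Σ< (suc r) (λ d → byFirstPart d γ)
    lhs γ nγ = trans (coeff-F⊥-suc r (HL a y) γ nγ)
      (Q.Σ<-cong (suc r) λ d _ → Q.ΣL-cong (C d) λ δ → Q.ΣL-cong (qsh (suc d ∷ δ) γ) (coeff-HL a y))

    rhs : ∀ γ → coeff (HL a (F⊥ (ℤ.+ suc r) y) ⊕ N.Σ< (suc r) G) γ
              ≡ HL-coeff a (coeff (F⊥ (ℤ.+ suc r) y)) γ + Q.Σ< (suc r) (λ d → shiftedTerm d γ)
    rhs γ = trans (coeff-⊕ (HL a (F⊥ (ℤ.+ suc r) y)) (N.Σ< (suc r) G) γ)
      (cong₂ _+_ (coeff-HL a (F⊥ (ℤ.+ suc r) y) γ)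
                 (trans (coeff-Σ< (suc r) G γ) (Q.Σ<-cong (suc r) λ d _ → coeff-HL (suc n ℤ.⊖ suc d) (F⊥ (ℤ.+ (r ∸ d)) y) γ)))

    byFirstPart-[] : ∀ d → byFirstPart d [] ≡ shiftedTerm d []
    byFirstPart-[] d = begin
      Q.ΣL (C d) (λ δ → when b (φ δ) + 0ℚ)  ≡⟨ Q.ΣL-cong (C d) (λ δ → ℚ.+-identityʳ _) ⟩
      Q.ΣL (C d) (λ δ → when b (φ δ))       ≡⟨ sym (when-ΣL b (C d) φ) ⟩
      when b (Q.ΣL (C d) φ)                  ≡⟨ cong (when b) (sym ψ-[]) ⟩
      when b (ψ d [])                        ≡⟨ sym (HL-coeff-⊖-[] n d (ψ d)) ⟩
      shiftedTerm d []                                 ∎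
      where
      open ≡-Reasoning
      b = does (n ℕ.≟ d)
      ψ-[] : ψ d [] ≡ Q.ΣL (C d) φ
      ψ-[] = trans (ψ-sum d [] []) (Q.ΣL-cong (C d) λ δ → trans (cong (λ L → Q.ΣL L φ) (qsh-[] δ)) (ℚ.+-identityʳ _))

    module _ (g : ℕ) (γ : Word) (nγ : Normal γ) where
      A Mid B : ℕ → ℚ
      A   d = when (does (n ℕ.≟ d)) (ψ d (suc g ∷ γ))
      Mid d = when (does (suc n ℕ.≟ suc g)) (Q.ΣL (C d) (λ δ → M⊥-coeff (suc d ∷ δ) φ γ))
      B   d = when (does (suc n ℕ.≟ suc d ℕ.+ suc g)) (ψ d γ)

      byFirstPart-∷ : ∀ d → byFirstPart d (suc g ∷ γ) ≡ A d + (Mid d + B d)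
      byFirstPart-∷ d = begin
        byFirstPart d (suc g ∷ γ)
          ≡⟨ Q.ΣL-cong (C d) (λ δ → M⊥-coeff-HL-∷ n φ (suc d) δ (suc g) γ) ⟩
        Q.ΣL (C d) (λ δ → b₁ (l₁ δ) + (b₂ (l₂ δ) + b₃ (l₃ δ)))
          ≡⟨ trans (Q.ΣL-distrib (C d) _ _) (cong (Q.ΣL (C d) (b₁ ∘ l₁) +_) (Q.ΣL-distrib (C d) _ _)) ⟩
        Q.ΣL (C d) (b₁ ∘ l₁) + (Q.ΣL (C d) (b₂ ∘ l₂) + Q.ΣL (C d) (b₃ ∘ l₃))
          ≡⟨ sym (cong₂ _+_ (when-ΣL _ (C d) l₁) (cong₂ _+_ (when-ΣL _ (C d) l₂) (when-ΣL _ (C d) l₃))) ⟩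
        b₁ (Q.ΣL (C d) l₁) + (b₂ (Q.ΣL (C d) l₂) + b₃ (Q.ΣL (C d) l₃))
          ≡⟨ sym (cong₂ _+_ (cong b₁ (ψ-sum d (suc g ∷ γ) (g ∷ nγ))) (cong (b₂ (Q.ΣL (C d) l₂) +_) (cong b₃ (ψ-sum d γ nγ)))) ⟩
        A d + (Mid d + B d) ∎
        where
        open ≡-Reasoning
        b₁ = when (does (n ℕ.≟ d))
        b₂ = when (does (suc n ℕ.≟ suc g))
        b₃ = when (does (suc n ℕ.≟ suc d ℕ.+ suc g))
        l₁ = λ δ → M⊥-coeff δ φ (suc g ∷ γ)
        l₂ = λ δ → M⊥-coeff (suc d ∷ δ) φ γ
        l₃ = λ δ → M⊥-coeff δ φ γ

      Mid-sum : Q.Σ< (suc r) Mid ≡ HL-coeff a (coeff (F⊥ (ℤ.+ suc r) y)) (suc g ∷ γ)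
      Mid-sum = trans (sym (when-Σ< _ (suc r) _)) (cong (when _) (sym (coeff-F⊥-suc r y γ nγ)))

    by-γ : ∀ γ → Normal γ →
      Q.Σ< (suc r) (λ d → byFirstPart d γ) ≡ HL-coeff a (coeff (F⊥ (ℤ.+ suc r) y)) γ + Q.Σ< (suc r) (λ d → shiftedTerm d γ)
    by-γ []          []        = trans (Q.Σ<-cong (suc r) λ d _ → byFirstPart-[] d) (sym (ℚ.+-identityˡ _))
    by-γ (suc g ∷ γ) (_ ∷ nγ) = begin
      Q.Σ< (suc r) (λ d → byFirstPart d (suc g ∷ γ))
        ≡⟨ Q.Σ<-cong (suc r) (λ d _ → trans (byFirstPart-∷ g γ nγ d) (x∙yz≈y∙xz (A′ d) (Mid′ d) (B′ d))) ⟩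
      Q.Σ< (suc r) (λ d → Mid′ d + (A′ d + B′ d))
        ≡⟨ Q.Σ<-distrib (suc r) Mid′ _ ⟩
      Q.Σ< (suc r) Mid′ + Q.Σ< (suc r) (λ d → A′ d + B′ d)
        ≡⟨ cong₂ _+_ (Mid-sum g γ nγ) (Q.Σ<-cong (suc r) λ d _ → sym (HL-coeff-⊖-∷ n d g (ψ d) γ)) ⟩
      HL-coeff a (coeff (F⊥ (ℤ.+ suc r) y)) (suc g ∷ γ) + Q.Σ< (suc r) (λ d → shiftedTerm d (suc g ∷ γ)) ∎
      where
      open ≡-Reasoning
      A′ = A g γ nγ
      Mid′ = Mid g γ nγ
      B′ = B g γ nγ

  F⊥1-HL-suc : ∀ n i y → F⊥1 (suc i) (HL (ℤ.+ suc n) y) ≋ HL (ℤ.+ suc n) (F⊥1 (suc i) y) ⊕ HL (ℤ.+ n) (F⊥1 i y)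
  F⊥1-HL-suc n i y = ≋-on-Normal λ γ nγ → trans (lhs γ nγ) (trans (by-γ n γ nγ) (sym (rhs γ)))
    where
    a = ℤ.+ suc n
    φ = coeff y
    1ⁱ = replicate i 1

    lhs : ∀ γ → Normal γ → coeff (F⊥1 (suc i) (HL a y)) γ ≡ M⊥-coeff (1 ∷ 1ⁱ) (HL-coeff a φ) γ
    lhs γ nγ = trans (coeff-F⊥1 (suc i) (HL a y) γ nγ) (Q.ΣL-cong (qsh (1 ∷ 1ⁱ) γ) (coeff-HL a y))

    rhs : ∀ γ → coeff (HL a (F⊥1 (suc i) y) ⊕ HL (ℤ.+ n) (F⊥1 i y)) γ
              ≡ HL-coeff a (coeff (F⊥1 (suc i) y)) γ + HL-coeff (ℤ.+ n) (coeff (F⊥1 i y)) γ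
    rhs γ = trans (coeff-⊕ (HL a (F⊥1 (suc i) y)) (HL (ℤ.+ n) (F⊥1 i y)) γ)
                  (cong₂ _+_ (coeff-HL a (F⊥1 (suc i) y) γ) (coeff-HL (ℤ.+ n) (F⊥1 i y) γ))

    by-γ : ∀ n γ → Normal γ → M⊥-coeff (1 ∷ 1ⁱ) (HL-coeff (ℤ.+ suc n) φ) γ
                            ≡ HL-coeff (ℤ.+ suc n) (coeff (F⊥1 (suc i) y)) γ + HL-coeff (ℤ.+ n) (coeff (F⊥1 i y)) γ
    by-γ zero [] [] = begin
      φ 1ⁱ + 0ℚ                       ≡⟨ sym (ℚ.+-identityˡ _) ⟩
      0ℚ + (φ 1ⁱ + 0ℚ)                ≡⟨ cong (λ L → 0ℚ + Q.ΣL L φ) (sym (qsh-[] 1ⁱ)) ⟩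
      0ℚ + M⊥-coeff 1ⁱ φ []           ≡⟨ cong (0ℚ +_) (sym (coeff-F⊥1 i y [] [])) ⟩
      0ℚ + coeff (F⊥1 i y) []         ∎
      where open ≡-Reasoning
    by-γ (suc m) [] [] = refl
    by-γ zero (suc g ∷ γ) (_ ∷ nγ) = begin
      M⊥-coeff (1 ∷ 1ⁱ) (HL-coeff (ℤ.+ 1) φ) (suc g ∷ γ)
        ≡⟨ M⊥-coeff-HL-∷ 0 φ 1 1ⁱ (suc g) γ ⟩
      M⊥-coeff 1ⁱ φ (suc g ∷ γ) + (b (M⊥-coeff (1 ∷ 1ⁱ) φ γ) + 0ℚ)
        ≡⟨ cong₂ _+_ (sym (coeff-F⊥1 i y (suc g ∷ γ) (g ∷ nγ))) (trans (ℚ.+-identityʳ _) (cong b (sym (coeff-F⊥1 (suc i) y γ nγ)))) ⟩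
      coeff (F⊥1 i y) (suc g ∷ γ) + b (coeff (F⊥1 (suc i) y) γ)
        ≡⟨ ℚ.+-comm (coeff (F⊥1 i y) (suc g ∷ γ)) _ ⟩
      b (coeff (F⊥1 (suc i) y) γ) + coeff (F⊥1 i y) (suc g ∷ γ) ∎
      where
      open ≡-Reasoning
      b = when (does (1 ℕ.≟ suc g))
    by-γ (suc m) (suc g ∷ γ) (_ ∷ nγ) = trans (M⊥-coeff-HL-∷ (suc m) φ 1 1ⁱ (suc g) γ) (trans (ℚ.+-identityˡ _)
      (cong₂ _+_ (cong (when (does (suc (suc m) ℕ.≟ suc g))) (sym (coeff-F⊥1 (suc i) y γ nγ)))
                 (cong (when (does (suc m ℕ.≟ suc g))) (sym (coeff-F⊥1 i y γ nγ)))))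

open import Data.Integer using (+_; -_; _+_; _-_)

HL-negative : ∀ m j y → HL (-[1+ m ] - + j) y ≡ 0N
HL-negative m zero    y = refl
HL-negative m (suc j) y = refl

F⊥-HL : ∀ b r y → F⊥ (+ r) (HL b y) ≋ N.Σ< (suc r) (λ j → HL (b - + j) (F⊥ (+ (r ∸ j)) y))
F⊥-HL -[1+ m ] r y = ≋-trans (0-hom (F⊥-linear (+ r)))
  (≋-sym (N.Σ<-zero (suc r) λ j _ → ≡⇒≋ (HL-negative m j _)))
F⊥-HL (+ zero) r y = ≋-sym (≋-trans (N.Σ<-head r _) (≋-trans (⊕-cong ≋-refl (N.Σ<-zero r λ j _ → ≋-refl)) (⊕-identityʳ _)))
F⊥-HL (+ suc n) zero y = ≋-trans (F⊥-0 _) (≋-sym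
  (≋-trans (≡⇒≋ (cong (λ b → HL b (F⊥ (+ 0) y)) (ℤ.+-identityʳ (+ suc n)))) (≋-cong (HL-linear _) (F⊥-0 y))))
F⊥-HL (+ suc n) (suc r) y = ≋-trans (F⊥-HL-suc n r y) (≋-sym (≋-trans (N.Σ<-head (suc r) _)
  (⊕-cong (≡⇒≋ (cong (λ b → HL b (F⊥ (+ suc r) y)) (ℤ.+-identityʳ (+ suc n)))) ≋-refl)))

-- F^⊥_{1^{k-1}}, read as 0 when k = 0.
F⊥1-pred : ℕ → Op
F⊥1-pred zero    _ = 0N
F⊥1-pred (suc k)   = F⊥1 k

F⊥1-HL : ∀ b k y → F⊥1 k (HL b y) ≋ HL b (F⊥1 k y) ⊕ HL (b - + 1) (F⊥1-pred k y)
F⊥1-HL b         zero    y = ≋-trans (F⊥1-0 _) (≋-sym (≋-trans (⊕-cong (≋-cong (HL-linear b) (F⊥1-0 y)) (0-hom (HL-linear (b - + 1)))) (⊕-identityʳ _)))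
F⊥1-HL -[1+ m ]  (suc k) y = 0-hom (F⊥1-linear (suc k))
F⊥1-HL (+ zero)  (suc k) y = ≋-sym (⊕-identityʳ _)
F⊥1-HL (+ suc n) (suc k) y = F⊥1-HL-suc n k y

-- Commutation of F^⊥_r with F^⊥_{1^k}

Commute : NSym → Set
Commute y = ∀ r k → F⊥ (+ r) (F⊥1 k y) ≋ F⊥1 k (F⊥ (+ r) y)

Commute-pred : ∀ {y} → Commute y → ∀ r k → F⊥ (+ r) (F⊥1-pred k y) ≋ F⊥1-pred k (F⊥ (+ r) y)
Commute-pred c r zero    = 0-hom (F⊥-linear (+ r))
Commute-pred c r (suc k) = c r k

Commute-resp : ∀ {x y} → x ≋ y → Commute x → Commute y
Commute-resp x≋y c r k = ≋-trans (≋-cong (∘-linear (F⊥-linear (+ r)) (F⊥1-linear k)) (≋-sym x≋y))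
                        (≋-trans (c r k) (≋-cong (∘-linear (F⊥1-linear k) (F⊥-linear (+ r))) x≋y))

Commute-H[] : Commute (H [])
Commute-H[] r       zero    = ≋-trans (≋-cong (F⊥-linear (+ r)) (F⊥1-0 (H []))) (≋-sym (F⊥1-0 _))
Commute-H[] zero    (suc k) = ≋-trans (F⊥-0 _) (≋-cong (F⊥1-linear (suc k)) (≋-sym (F⊥-0 (H []))))
Commute-H[] (suc r) (suc k) = ≋-refl

Commute-HL : ∀ b y → Commute y → Commute (HL b y)
Commute-HL b y c r k = begin
  F⊥ (+ r) (F⊥1 k (HL b y))
    ≈⟨ ≋-cong (F⊥-linear (+ r)) (F⊥1-HL b k y) ⟩
  F⊥ (+ r) (HL b X ⊕ HL (b - + 1) X′)
    ≈⟨ ≋-trans (⊕-hom (F⊥-linear (+ r)) _ _) (⊕-cong (F⊥-HL b r X) (F⊥-HL (b - + 1) r X′)) ⟩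
  N.Σ< (suc r) (λ j → HL (b - + j) (F⊥ (+ (r ∸ j)) X)) ⊕ N.Σ< (suc r) (λ j → HL (b - + 1 - + j) (F⊥ (+ (r ∸ j)) X′))
    ≈⟨ ≋-sym (N.Σ<-distrib (suc r) _ _) ⟩
  N.Σ< (suc r) (λ j → HL (b - + j) (F⊥ (+ (r ∸ j)) X) ⊕ HL (b - + 1 - + j) (F⊥ (+ (r ∸ j)) X′))
    ≈⟨ N.Σ<-cong (suc r) (λ j _ → ⊕-cong (≋-cong (HL-linear (b - + j)) (c (r ∸ j) k))
         (≋-trans (≋-cong (HL-linear (b - + 1 - + j)) (Commute-pred c (r ∸ j) k))
                  (≡⇒≋ (cong (λ a → HL a (F⊥1-pred k (Y j))) (shift b (+ j)))))) ⟩
  N.Σ< (suc r) (λ j → HL (b - + j) (F⊥1 k (Y j)) ⊕ HL (b - + j - + 1) (F⊥1-pred k (Y j)))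
    ≈⟨ N.Σ<-cong (suc r) (λ j _ → ≋-sym (F⊥1-HL (b - + j) k (Y j))) ⟩
  N.Σ< (suc r) (λ j → F⊥1 k (HL (b - + j) (Y j)))
    ≈⟨ ≋-sym (Σ<-hom (F⊥1-linear k) (suc r) _) ⟩
  F⊥1 k (N.Σ< (suc r) (λ j → HL (b - + j) (Y j)))
    ≈⟨ ≋-cong (F⊥1-linear k) (≋-sym (F⊥-HL b r y)) ⟩
  F⊥1 k (F⊥ (+ r) (HL b y)) ∎
  where
  open ≋-Reasoning
  X = F⊥1 k y
  X′ = F⊥1-pred k y
  Y : ℕ → NSym
  Y j = F⊥ (+ (r ∸ j)) y
  shift : ∀ b e → b - + 1 - e ≡ b - e - + 1
  shift = ℤ-Solver.solve-∀

F⊥-F⊥1-comm : ∀ r k x → F⊥ (+ r) (F⊥1 k x) ≋ F⊥1 k (F⊥ (+ r) x)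
F⊥-F⊥1-comm r k = linear-ext (∘-linear (F⊥-linear (+ r)) (F⊥1-linear k)) (∘-linear (F⊥1-linear k) (F⊥-linear (+ r)))
  (λ w → H-induction Commute Commute-resp Commute-H[] (λ n → Commute-HL (+ suc n)) w r k)

-- The alternating sums

∸-comm : ∀ t k j → t ∸ k ∸ j ≡ t ∸ j ∸ k
∸-comm t k j = trans (ℕ.∸-+-assoc t k j) (trans (cong (t ∸_) (ℕ.+-comm k j)) (sym (ℕ.∸-+-assoc t j k)))

suc-∸ : ∀ {t k} → k < suc t → suc (t ∸ k) ≡ suc t ∸ k
suc-∸ k<1+t = sym (ℕ.+-∸-assoc 1 (ℕ.≤-pred k<1+t))

alternating alternating-pred : ℕ → Op
alternating      t y = N.Σ< (suc t) (λ k → scale (sign k) (F⊥1 k (F⊥ (+ (t ∸ k)) y)))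
alternating-pred t y = N.Σ< (suc t) (λ k → scale (sign k) (F⊥1-pred k (F⊥ (+ (t ∸ k)) y)))

alternating-linear : ∀ t → IsLinear (alternating t)
alternating-linear t = Σ<-linear (suc t) _ λ k →
  ∘-linear (scale-linear (sign k)) (∘-linear (F⊥1-linear k) (F⊥-linear (+ (t ∸ k))))

alternating-0 : ∀ y → alternating 0 y ≋ y
alternating-0 y = ≋-trans (scale-1 _) (≋-trans (F⊥1-0 _) (F⊥-0 y))

⊖-scale : ∀ a x → ⊖ scale a x ≋ scale (ℚ.- a) x
⊖-scale a x = ≋-trans (scale-scale (ℚ.- 1ℚ) a x) (≡⇒≋ (cong (λ q → scale q x) (-1*x≈-x a)))

alternating-pred-suc : ∀ u y → alternating-pred (suc u) y ≋ ⊖ alternating u y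
alternating-pred-suc u y = begin
  alternating-pred (suc u) y
    ≈⟨ N.Σ<-head (suc u) _ ⟩
  scale 1ℚ 0N ⊕ N.Σ< (suc u) (λ k → scale (sign (suc k)) (F⊥1 k (F⊥ (+ (u ∸ k)) y)))
    ≈⟨ N.Σ<-cong (suc u) (λ k _ → ≋-sym (⊖-scale (sign k) _)) ⟩
  N.Σ< (suc u) (λ k → ⊖ scale (sign k) (F⊥1 k (F⊥ (+ (u ∸ k)) y)))
    ≈⟨ ≋-sym (Σ<-hom (scale-linear (ℚ.- 1ℚ)) (suc u) _) ⟩
  ⊖ alternating u y ∎
  where open ≋-Reasoning

alternating-HL : ∀ b t y → alternating t (HL b y) ≋
  N.Σ< (suc t) (λ j → HL (b - + j) (alternating (t ∸ j) y) ⊕ HL (b - + j - + 1) (alternating-pred (t ∸ j) y))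
alternating-HL b t y = begin
  N.Σ< (suc t) (λ k → term k (t ∸ k) (HL b y))
    ≈⟨ N.Σ<-cong (suc t) (λ k _ → term-HL k (t ∸ k)) ⟩
  N.Σ< (suc t) (λ k → N.Σ< (suc (t ∸ k)) (R k))
    ≈⟨ N.Σ<-cong (suc t) (λ k k≤t → ≡⇒≋ (cong (λ n → N.Σ< n (R k)) (suc-∸ k≤t))) ⟩
  N.Σ< (suc t) (λ k → N.Σ< (suc t ∸ k) (R k))
    ≈⟨ N.Σ<-transpose (suc t) R ⟩
  N.Σ< (suc t) (λ j → N.Σ< (suc t ∸ j) (λ k → R k j))
    ≈⟨ N.Σ<-cong (suc t) (λ j j≤t → regroup j j≤t) ⟩
  N.Σ< (suc t) (λ j → HL (b - + j) (alternating (t ∸ j) y) ⊕ HL (b - + j - + 1) (alternating-pred (t ∸ j) y)) ∎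
  where
  open ≋-Reasoning
  term term′ : ℕ → ℕ → Op
  term  k u z = scale (sign k) (F⊥1 k (F⊥ (+ u) z))
  term′ k u z = scale (sign k) (F⊥1-pred k (F⊥ (+ u) z))
  R : ℕ → ℕ → NSym
  R k j = HL (b - + j) (term k (t ∸ k ∸ j) y) ⊕ HL (b - + j - + 1) (term′ k (t ∸ k ∸ j) y)

  scaled-F⊥1-HL : ∀ k c z → scale (sign k) (F⊥1 k (HL c z)) ≋ HL c (scale (sign k) (F⊥1 k z)) ⊕ HL (c - + 1) (scale (sign k) (F⊥1-pred k z))
  scaled-F⊥1-HL k c z = ≋-trans (scale-cong (sign k) (F⊥1-HL c k z))
    (≋-trans (⊕-hom (scale-linear (sign k)) (HL c (F⊥1 k z)) (HL (c - + 1) (F⊥1-pred k z)))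
             (⊕-cong (≋-sym (scale-hom (HL-linear c) (sign k) (F⊥1 k z)))
                     (≋-sym (scale-hom (HL-linear (c - + 1)) (sign k) (F⊥1-pred k z)))))

  term-HL : ∀ k u → term k u (HL b y) ≋
    N.Σ< (suc u) (λ j → HL (b - + j) (term k (u ∸ j) y) ⊕ HL (b - + j - + 1) (term′ k (u ∸ j) y))
  term-HL k u = ≋-trans (≋-cong (∘-linear (scale-linear (sign k)) (F⊥1-linear k)) (F⊥-HL b u y))
    (≋-trans (Σ<-hom (∘-linear (scale-linear (sign k)) (F⊥1-linear k)) (suc u) _)
             (N.Σ<-cong (suc u) (λ j _ → scaled-F⊥1-HL k (b - + j) (F⊥ (+ (u ∸ j)) y))))

  regroup : ∀ j → j < suc t → N.Σ< (suc t ∸ j) (λ k → R k j)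
    ≋ HL (b - + j) (alternating (t ∸ j) y) ⊕ HL (b - + j - + 1) (alternating-pred (t ∸ j) y)
  regroup j j≤t = begin
    N.Σ< (suc t ∸ j) (λ k → R k j)
      ≈⟨ ≡⇒≋ (cong (λ n → N.Σ< n (λ k → R k j)) (sym (suc-∸ j≤t))) ⟩
    N.Σ< (suc (t ∸ j)) (λ k → R k j)
      ≈⟨ N.Σ<-cong (suc (t ∸ j)) (λ k _ → ≡⇒≋ (cong (λ u → HL (b - + j) (term k u y) ⊕ HL (b - + j - + 1) (term′ k u y)) (∸-comm t k j))) ⟩
    N.Σ< (suc (t ∸ j)) (λ k → HL (b - + j) (term k (t ∸ j ∸ k) y) ⊕ HL (b - + j - + 1) (term′ k (t ∸ j ∸ k) y))
      ≈⟨ N.Σ<-distrib (suc (t ∸ j)) _ _ ⟩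
    N.Σ< (suc (t ∸ j)) (λ k → HL (b - + j) (term k (t ∸ j ∸ k) y)) ⊕ N.Σ< (suc (t ∸ j)) (λ k → HL (b - + j - + 1) (term′ k (t ∸ j ∸ k) y))
      ≈⟨ ≋-sym (⊕-cong (Σ<-hom (HL-linear (b - + j)) (suc (t ∸ j)) _) (Σ<-hom (HL-linear (b - + j - + 1)) (suc (t ∸ j)) _)) ⟩
    HL (b - + j) (alternating (t ∸ j) y) ⊕ HL (b - + j - + 1) (alternating-pred (t ∸ j) y) ∎

AlternatingVanishes : NSym → Set
AlternatingVanishes y = ∀ t → alternating (suc t) y ≋ 0N

AlternatingVanishes-resp : ∀ {x y} → x ≋ y → AlternatingVanishes x → AlternatingVanishes y
AlternatingVanishes-resp x≋y v t = ≋-trans (≋-cong (alternating-linear (suc t)) (≋-sym x≋y)) (v t)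

AlternatingVanishes-H[] : AlternatingVanishes (H [])
AlternatingVanishes-H[] t = N.Σ<-zero (suc (suc t)) vanish
  where
  vanish : ∀ k → k < suc (suc t) → scale (sign k) (F⊥1 k (F⊥ (+ (suc t ∸ k)) (H []))) ≋ 0N
  vanish zero    _   = ≋-refl
  vanish (suc k) k<t = ≡⇒≋ (cong (scale (sign (suc k))) (F⊥1-suc-F⊥-H[] (t ∸ k)))
    where
    F⊥1-suc-F⊥-H[] : ∀ j → F⊥1 (suc k) (F⊥ (+ j) (H [])) ≡ 0N
    F⊥1-suc-F⊥-H[] zero    = refl
    F⊥1-suc-F⊥-H[] (suc j) = refl

AlternatingVanishes-HL : ∀ b y → AlternatingVanishes y → AlternatingVanishes (HL b y)
AlternatingVanishes-HL b y vanishes t = begin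
  alternating (suc t) (HL b y)                   ≈⟨ alternating-HL b (suc t) y ⟩
  (N.Σ< t f ⊕ f t) ⊕ f (suc t)                   ≈⟨ ⊕-cong (⊕-cong (N.Σ<-zero t early) penultimate) last ⟩
  (0N ⊕ (⊖ HL (b - + suc t) y)) ⊕ HL (b - + suc t) y ≈⟨ ⊖-inverseˡ (HL (b - + suc t) y) ⟩
  0N                                             ∎
  where
  open ≋-Reasoning
  f : ℕ → NSym
  f j = HL (b - + j) (alternating (suc t ∸ j) y) ⊕ HL (b - + j - + 1) (alternating-pred (suc t ∸ j) y)
  alternating≡ : ∀ {m n} → m ≡ n → alternating m y ≋ alternating n y
  alternating≡ eq = ≡⇒≋ (cong (λ n → alternating n y) eq)
  alternating-pred≡ : ∀ {m n} → m ≡ n → alternating-pred m y ≋ alternating-pred n y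
  alternating-pred≡ eq = ≡⇒≋ (cong (λ n → alternating-pred n y) eq)

  early : ∀ j → j < t → f j ≋ 0N
  early j j<t = ≋-trans (⊕-cong (≋0-hom (HL-linear (b - + j)) first-vanishes)
                                 (≋0-hom (HL-linear (b - + j - + 1)) second-vanishes))
                        (⊕-identityʳ 0N)
    where
    suc-t∸j : suc t ∸ j ≡ suc (t ∸ j)
    suc-t∸j = sym (suc-∸ (ℕ.m<n⇒m<1+n j<t))
    first-vanishes : alternating (suc t ∸ j) y ≋ 0N
    first-vanishes = ≋-trans (alternating≡ suc-t∸j) (vanishes (t ∸ j))
    second-vanishes : alternating-pred (suc t ∸ j) y ≋ 0N
    second-vanishes = begin
      alternating-pred (suc t ∸ j) y      ≈⟨ alternating-pred≡ suc-t∸j ⟩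
      alternating-pred (suc (t ∸ j)) y    ≈⟨ alternating-pred-suc (t ∸ j) y ⟩
      ⊖ alternating (t ∸ j) y             ≈⟨ ≋-cong (scale-linear (ℚ.- 1ℚ)) (alternating≡ (ℕ.+-∸-assoc 1 j<t)) ⟩
      ⊖ alternating (suc (t ∸ suc j)) y   ≈⟨ ≋0-hom (scale-linear (ℚ.- 1ℚ)) (vanishes (t ∸ suc j)) ⟩
      0N                                  ∎

  penultimate : f t ≋ ⊖ HL (b - + suc t) y
  penultimate = ⊕-cong (≋0-hom (HL-linear (b - + t)) (≋-trans (alternating≡ t+1∸t≡1) (vanishes 0))) (begin
    HL (b - + t - + 1) (alternating-pred (suc t ∸ t) y)
      ≈⟨ ≋-cong (HL-linear (b - + t - + 1)) (alternating-pred≡ t+1∸t≡1) ⟩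
    HL (b - + t - + 1) (alternating-pred 1 y)
      ≈⟨ ≋-cong (HL-linear (b - + t - + 1)) (alternating-pred-suc 0 y) ⟩
    HL (b - + t - + 1) (⊖ alternating 0 y)
      ≈⟨ ≋-cong (HL-linear (b - + t - + 1)) (≋-cong (scale-linear (ℚ.- 1ℚ)) (alternating-0 y)) ⟩
    HL (b - + t - + 1) (⊖ y)
      ≈⟨ ⊖-hom (HL-linear (b - + t - + 1)) y ⟩
    ⊖ HL (b - + t - + 1) y
      ≡⟨ cong (λ c → ⊖ HL c y) (b-t-1 b (+ t)) ⟩
    ⊖ HL (b - + suc t) y                               ∎)
    where
    t+1∸t≡1 : suc t ∸ t ≡ 1
    t+1∸t≡1 = trans (sym (suc-∸ (ℕ.n<1+n t))) (cong suc (ℕ.n∸n≡0 t))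
    b-t-1 : ∀ b t → b - t - + 1 ≡ b - (+ 1 + t)
    b-t-1 = ℤ-Solver.solve-∀

  last : f (suc t) ≋ HL (b - + suc t) y
  last = ≋-trans (⊕-cong (≋-cong (HL-linear (b - + suc t)) (≋-trans (alternating≡ (ℕ.n∸n≡0 t)) (alternating-0 y)))
                         (≋0-hom (HL-linear (b - + suc t - + 1)) (alternating-pred≡ (ℕ.n∸n≡0 t))))
                 (⊕-identityʳ _)

alternating-vanishes : ∀ t y → alternating (suc t) y ≋ 0N
alternating-vanishes t = linear-ext (alternating-linear (suc t)) 0-linear
  (λ w → H-induction AlternatingVanishes AlternatingVanishes-resp AlternatingVanishes-H[] (λ n → AlternatingVanishes-HL (+ suc n)) w t)

size-normalise : ∀ w → size (normalise w) ≡ size w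
size-normalise []          = refl
size-normalise (zero ∷ w)  = size-normalise w
size-normalise (suc a ∷ w) = cong (suc a ℕ.+_) (size-normalise w)

size-1ⁱ : ∀ i → size (replicate i 1) ≡ i
size-1ⁱ zero    = refl
size-1ⁱ (suc i) = cong suc (size-1ⁱ i)

deg-⊕ : ∀ x y → deg (x ⊕ y) ≡ deg x ⊔ deg y
deg-⊕ []            y = refl
deg-⊕ ((c , w) ∷ x) y = trans (cong (size w ⊔_) (deg-⊕ x y)) (sym (ℕ.⊔-assoc (size w) (deg x) (deg y)))

size-normalise≤deg : ∀ c w x → size (normalise w) ≤ deg ((c , w) ∷ x)
size-normalise≤deg c w x = subst (_≤ size w ⊔ deg x) (sym (size-normalise w)) (ℕ.m≤m⊔n (size w) (deg x))

perpHom-vanishes : ∀ k f x → deg x < k → perpHom k f x ≡ 0N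
perpHom-vanishes k f []            _ = refl
perpHom-vanishes k f ((c , w) ∷ x) x<k with k ≤ᵇ size (normalise w) in k≤ᵇ|w|
... | true  = ⊥-elim (ℕ.<⇒≱ (ℕ.≤-<-trans (size-normalise≤deg c w x) x<k) (ℕ.≤ᵇ⇒≤ k _ (subst T (sym k≤ᵇ|w|) _)))
... | false = perpHom-vanishes k f x (ℕ.≤-<-trans (ℕ.m≤n⊔m (size w) (deg x)) x<k)

deg-comps : ∀ n (φ : Word → ℚ) → deg (map (λ γ → (φ γ , γ)) (comps n)) ≤ n
deg-comps n φ = go (comps n) (All.map proj₂ (comps-Comp n))
  where
  go : ∀ L → All (λ w → size w ≡ n) L → deg (map (λ γ → (φ γ , γ)) L) ≤ n
  go []      []       = z≤n
  go (w ∷ L) (e ∷ es) = ℕ.⊔-lub (ℕ.≤-reflexive e) (go L es)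

deg-perpHom : ∀ k f x → deg (perpHom k f x) ≤ deg x ∸ k
deg-perpHom k f []            = z≤n
deg-perpHom k f ((c , w) ∷ x) = subst (_≤ (size w ⊔ deg x) ∸ k) (sym (deg-⊕ (perpTerm k f c (normalise w)) (perpHom k f x)))
  (ℕ.⊔-lub deg-term (ℕ.≤-trans (deg-perpHom k f x) (ℕ.∸-monoˡ-≤ k (ℕ.m≤n⊔m (size w) (deg x)))))
  where
  deg-term : deg (perpTerm k f c (normalise w)) ≤ (size w ⊔ deg x) ∸ k
  deg-term with k ≤ᵇ size (normalise w)
  ... | false = z≤n
  ... | true  = ℕ.≤-trans (deg-comps (size (normalise w) ∸ k) _) (ℕ.∸-monoˡ-≤ k (size-normalise≤deg c w x))

F⊥-vanishes : ∀ p x → deg x < p → F⊥ (+ p) x ≡ 0N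
F⊥-vanishes (suc p) x x<p = perpHom-vanishes (suc p ℕ.+ 0) (Fq (suc p ∷ [])) x (subst (deg x <_) (sym (ℕ.+-identityʳ (suc p))) x<p)

F⊥1-vanishes : ∀ k x → deg x < k → F⊥1 k x ≡ 0N
F⊥1-vanishes k x x<k = perpHom-vanishes (size (replicate k 1)) (Fq (replicate k 1)) x (subst (deg x <_) (sym (size-1ⁱ k)) x<k)

deg-F⊥ : ∀ p x → deg (F⊥ (+ p) x) ≤ deg x ∸ p
deg-F⊥ zero    x = deg-perpHom 0 (Fq []) x
deg-F⊥ (suc p) x = subst (λ j → deg (F⊥ (+ suc p) x) ≤ deg x ∸ j) (ℕ.+-identityʳ (suc p)) (deg-perpHom (suc p ℕ.+ 0) (Fq (suc p ∷ [])) x)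

-- The operators 𝔹_m

sumℕ≡Σ< : ∀ n f → sumℕ n f ≡ N.Σ< n f
sumℕ≡Σ< zero    f = refl
sumℕ≡Σ< (suc n) f = cong (_⊕ f n) (sumℕ≡Σ< n f)

sumFrom-Σ< : ∀ a n f → sumFrom a n f ≋ N.Σ< n (λ p → f (a + + p))
sumFrom-Σ< a zero    f = ≋-refl
sumFrom-Σ< a (suc n) f = begin
  f a ⊕ sumFrom (a + + 1) n f                   ≈⟨ ⊕-cong (≡⇒≋ (cong f (sym (ℤ.+-identityʳ a)))) (sumFrom-Σ< (a + + 1) n f) ⟩
  f (a + + 0) ⊕ N.Σ< n (λ p → f (a + + 1 + + p)) ≈⟨ ⊕-cong ≋-refl (N.Σ<-cong n λ p _ → ≡⇒≋ (cong f (ℤ.+-assoc a (+ 1) (+ p)))) ⟩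
  f (a + + 0) ⊕ N.Σ< n (λ p → f (a + + suc p))   ≈⟨ ≋-sym (N.Σ<-head n (λ p → f (a + + p))) ⟩
  N.Σ< (suc n) (λ p → f (a + + p))               ∎
  where open ≋-Reasoning

𝔹≤ : ℕ → ℤ → Op
𝔹≤ n m y = N.Σ< n (λ i → scale (sign i) (HL (m + + i) (F⊥1 i y)))

𝔹≤-linear : ∀ n m → IsLinear (𝔹≤ n m)
𝔹≤-linear n m = Σ<-linear n _ λ i → ∘-linear (scale-linear (sign i)) (∘-linear (HL-linear (m + + i)) (F⊥1-linear i))

scale-HL-F⊥1-vanishes : ∀ s c k y → deg y < k → scale s (HL c (F⊥1 k y)) ≋ 0N
scale-HL-F⊥1-vanishes s c k y y<k rewrite F⊥1-vanishes k y y<k = ≋0-hom (∘-linear (scale-linear s) (HL-linear c)) ≋-refl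

𝔹≋𝔹≤ : ∀ n m y → deg y < n → 𝔹 m y ≋ 𝔹≤ n m y
𝔹≋𝔹≤ n m y y<n = ≋-trans (≡⇒≋ (sumℕ≡Σ< (suc (deg y)) _)) (≋-sym (N.Σ<-truncate _ y<n vanish))
  where
  vanish : ∀ i → suc (deg y) ≤ i → i < n → scale (sign i) (HL (m + + i) (F⊥1 i y)) ≋ 0N
  vanish i y<i _ = scale-HL-F⊥1-vanishes (sign i) (m + + i) i y y<i

deg-F⊥< : ∀ p x → deg (F⊥ (+ p) x) < suc (deg x)
deg-F⊥< p x = s≤s (ℕ.≤-trans (deg-F⊥ p x) (ℕ.m∸n≤m (deg x) p))

+r-+k : ∀ {r k} → k ≤ r → + r - + k ≡ + (r ∸ k)
+r-+k {r} {k} k≤r = trans (ℤ.m-n≡m⊖n r k) (ℤ.⊖-≥ k≤r)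

F⊥-𝔹 : ∀ m r x → F⊥ (+ r) (𝔹 m x) ≋ N.Σ< (suc r) (λ k → 𝔹 (m - + k) (F⊥ (+ r - + k) x))
F⊥-𝔹 m r x = begin
  F⊥ (+ r) (𝔹 m x)
    ≈⟨ ≋-cong (F⊥-linear (+ r)) (𝔹≋𝔹≤ n m x ℕ.≤-refl) ⟩
  F⊥ (+ r) (N.Σ< n (λ i → scale (sign i) (HL (m + + i) (F⊥1 i x))))
    ≈⟨ Σ<-hom (F⊥-linear (+ r)) n _ ⟩
  N.Σ< n (λ i → F⊥ (+ r) (scale (sign i) (HL (m + + i) (F⊥1 i x))))
    ≈⟨ N.Σ<-cong n (λ i _ → term i) ⟩
  N.Σ< n (λ i → N.Σ< (suc r) (λ k → scale (sign i) (HL (m + + i - + k) (F⊥ (+ (r ∸ k)) (F⊥1 i x)))))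
    ≈⟨ N.Σ<-comm n (suc r) _ ⟩
  N.Σ< (suc r) (λ k → N.Σ< n (λ i → scale (sign i) (HL (m + + i - + k) (F⊥ (+ (r ∸ k)) (F⊥1 i x)))))
    ≈⟨ N.Σ<-cong (suc r) (λ k k≤r → shifted k k≤r) ⟩
  N.Σ< (suc r) (λ k → 𝔹 (m - + k) (F⊥ (+ r - + k) x)) ∎
  where
  open ≋-Reasoning
  n = suc (deg x)
  term : ∀ i → F⊥ (+ r) (scale (sign i) (HL (m + + i) (F⊥1 i x)))
             ≋ N.Σ< (suc r) (λ k → scale (sign i) (HL (m + + i - + k) (F⊥ (+ (r ∸ k)) (F⊥1 i x))))
  term i = ≋-trans (scale-hom (F⊥-linear (+ r)) (sign i) _)
    (≋-trans (scale-cong (sign i) (F⊥-HL (m + + i) r (F⊥1 i x))) (Σ<-hom (scale-linear (sign i)) (suc r) _))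
  reorder : ∀ m i k → m + i - k ≡ m - k + i
  reorder = ℤ-Solver.solve-∀
  shifted : ∀ k → k < suc r → N.Σ< n (λ i → scale (sign i) (HL (m + + i - + k) (F⊥ (+ (r ∸ k)) (F⊥1 i x))))
                             ≋ 𝔹 (m - + k) (F⊥ (+ r - + k) x)
  shifted k k≤r = begin
    N.Σ< n (λ i → scale (sign i) (HL (m + + i - + k) (F⊥ (+ (r ∸ k)) (F⊥1 i x))))
      ≈⟨ N.Σ<-cong n (λ i _ → scale-cong (sign i)
           (≋-trans (≡⇒≋ (cong (λ c → HL c (F⊥ (+ (r ∸ k)) (F⊥1 i x))) (reorder m (+ i) (+ k))))
                    (≋-cong (HL-linear (m - + k + + i)) (F⊥-F⊥1-comm (r ∸ k) i x)))) ⟩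
    𝔹≤ n (m - + k) (F⊥ (+ (r ∸ k)) x)
      ≈⟨ ≋-sym (𝔹≋𝔹≤ n (m - + k) (F⊥ (+ (r ∸ k)) x) (deg-F⊥< (r ∸ k) x)) ⟩
    𝔹 (m - + k) (F⊥ (+ (r ∸ k)) x)
      ≡⟨ cong (λ c → 𝔹 (m - + k) (F⊥ c x)) (sym (+r-+k (ℕ.≤-pred k≤r))) ⟩
    𝔹 (m - + k) (F⊥ (+ r - + k) x) ∎

-- Regrouping along p + k = t leaves Σ_t H^L_{a+t} Σ_{k ≤ t} (-1)^k F^⊥_{1^k} F^⊥_{t-k}, where only t = 0 survives.
Σ-𝔹-F⊥ : ∀ a x → N.Σ< (suc (deg x)) (λ p → 𝔹 (a + + p) (F⊥ (+ p) x)) ≋ HL a x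
Σ-𝔹-F⊥ a x = begin
  N.Σ< n (λ p → 𝔹 (a + + p) (F⊥ (+ p) x))
    ≈⟨ N.Σ<-cong n (λ p _ → 𝔹≋𝔹≤ n (a + + p) (F⊥ (+ p) x) (deg-F⊥< p x)) ⟩
  N.Σ< n (λ p → N.Σ< n (g p))
    ≈⟨ N.Σ<-cong n (λ p p<n → N.Σ<-truncate (g p) (ℕ.m∸n≤m n p) (vanish p p<n)) ⟩
  N.Σ< n (λ p → N.Σ< (n ∸ p) (g p))
    ≈⟨ N.Σ<-triangle n g ⟩
  N.Σ< n (λ t → N.Σ< (suc t) (λ k → g (t ∸ k) k))
    ≈⟨ N.Σ<-cong n (λ t _ → ≋-trans (N.Σ<-cong (suc t) (diagonal t)) (≋-sym (Σ<-hom (HL-linear (a + + t)) (suc t) _))) ⟩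
  N.Σ< n (λ t → HL (a + + t) (alternating t x))
    ≈⟨ N.Σ<-head (deg x) _ ⟩
  HL (a + + 0) (alternating 0 x) ⊕ N.Σ< (deg x) (λ t → HL (a + + suc t) (alternating (suc t) x))
    ≈⟨ ⊕-cong (≋-trans (≡⇒≋ (cong (λ b → HL b (alternating 0 x)) (ℤ.+-identityʳ a))) (≋-cong (HL-linear a) (alternating-0 x)))
              (N.Σ<-zero (deg x) (λ t _ → ≋0-hom (HL-linear (a + + suc t)) (alternating-vanishes t x))) ⟩
  HL a x ⊕ 0N
    ≈⟨ ⊕-identityʳ (HL a x) ⟩
  HL a x ∎
  where
  open ≋-Reasoning
  n = suc (deg x)
  g : ℕ → ℕ → NSym
  g p k = scale (sign k) (HL (a + + p + + k) (F⊥1 k (F⊥ (+ p) x)))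
  vanish : ∀ p → p < n → ∀ k → n ∸ p ≤ k → k < n → g p k ≋ 0N
  vanish p p<n k n∸p≤k _ = scale-HL-F⊥1-vanishes (sign k) (a + + p + + k) k (F⊥ (+ p) x) deg<k
    where
    deg<k : deg (F⊥ (+ p) x) < k
    deg<k = ℕ.<-≤-trans (s≤s (deg-F⊥ p x)) (subst (_≤ k) (sym (suc-∸ p<n)) n∸p≤k)
  diagonal : ∀ t k → k < suc t → g (t ∸ k) k ≋ HL (a + + t) (scale (sign k) (F⊥1 k (F⊥ (+ (t ∸ k)) x)))
  diagonal t k k≤t = ≋-trans (≋-sym (scale-hom (HL-linear (a + + (t ∸ k) + + k)) (sign k) (F⊥1 k (F⊥ (+ (t ∸ k)) x))))
    (≡⇒≋ (cong (λ b → HL b (scale (sign k) (F⊥1 k (F⊥ (+ (t ∸ k)) x))))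
               (trans (ℤ.+-assoc a (+ (t ∸ k)) (+ k)) (cong (λ j → a + + j) (ℕ.m∸n+n≡m (ℕ.≤-pred k≤t))))))

𝔹-resp : ∀ m {x y} → x ≋ y → 𝔹 m x ≋ 𝔹 m y
𝔹-resp m {x} {y} x≋y = begin
  𝔹 m x       ≈⟨ 𝔹≋𝔹≤ n m x (s≤s (ℕ.m≤m⊔n (deg x) (deg y))) ⟩
  𝔹≤ n m x    ≈⟨ ≋-cong (𝔹≤-linear n m) x≋y ⟩
  𝔹≤ n m y    ≈⟨ ≋-sym (𝔹≋𝔹≤ n m y (s≤s (ℕ.m≤n⊔m (deg x) (deg y)))) ⟩
  𝔹 m y       ∎
  where
  open ≋-Reasoning
  n = suc (deg x ⊔ deg y)

𝔹-0N : ∀ m → 𝔹 m 0N ≋ 0N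
𝔹-0N m = ≋-trans (𝔹≋𝔹≤ 1 m 0N (s≤s ℕ.z≤n)) (0-hom (𝔹≤-linear 1 m))

𝔹-F⊥-vanishes : ∀ b p x → deg x < p → 𝔹 b (F⊥ (+ p) x) ≋ 0N
𝔹-F⊥-vanishes b p x x<p rewrite F⊥-vanishes p x x<p = 𝔹-0N b

Σ𝔹F-Σ< : ∀ b c x → Σ𝔹F b (+ c) x ≋ N.Σ< (suc (deg x)) (λ p → 𝔹 (b + + p) (F⊥ (b + + c + + p) x))
Σ𝔹F-Σ< b c x = ≋-trans (sumFrom-Σ< b (suc (deg x)) _)
  (N.Σ<-cong (suc (deg x)) λ p _ → ≡⇒≋ (cong (λ i → 𝔹 (b + + p) (F⊥ i x)) (swap b (+ p) (+ c))))
  where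
  swap : ∀ b p c → b + p + c ≡ b + c + p
  swap = ℤ-Solver.solve-∀

-- Partial sums of Σ_{i ≥ -c} 𝔹_i F^⊥_{i+c}, indexed by j = i + c.
𝔹-partial-sums : ∀ c k x →
  N.Σ< k (λ j → 𝔹 (- + c + + j) (F⊥ (+ j) x)) ⊕ Σ𝔹F (- + c + + k) (+ c) x ≋ HL (- + c) x
𝔹-partial-sums c k x = begin
  N.Σ< k d ⊕ Σ𝔹F (- + c + + k) (+ c) x
    ≈⟨ ⊕-cong (≋-refl {N.Σ< k d}) (≋-trans (Σ𝔹F-Σ< (- + c + + k) c x) (N.Σ<-cong n λ p _ → ≡⇒≋ (shift p))) ⟩
  N.Σ< k d ⊕ N.Σ< n (λ p → d (k ℕ.+ p))
    ≈⟨ ≋-sym (N.Σ<-split k n d) ⟩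
  N.Σ< (k ℕ.+ n) d
    ≈⟨ N.Σ<-truncate d (ℕ.m≤n+m n k) (λ j n≤j _ → 𝔹-F⊥-vanishes (- + c + + j) j x n≤j) ⟩
  N.Σ< n d
    ≈⟨ Σ-𝔹-F⊥ (- + c) x ⟩
  HL (- + c) x                                   ∎
  where
  open ≋-Reasoning
  n = suc (deg x)
  d : ℕ → NSym
  d j = 𝔹 (- + c + + j) (F⊥ (+ j) x)
  reassoc : ∀ a k p → a + k + p ≡ a + (k + p)
  reassoc = ℤ-Solver.solve-∀
  cancel : ∀ c k p → - c + k + c + p ≡ k + p
  cancel = ℤ-Solver.solve-∀
  shift : ∀ p → 𝔹 (- + c + + k + + p) (F⊥ (- + c + + k + + c + + p) x) ≡ d (k ℕ.+ p)
  shift p = cong₂ (λ i j → 𝔹 i (F⊥ j x))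
    (trans (reassoc (- + c) (+ k) (+ p)) (cong (λ j → - + c + j) (sym (ℤ.pos-+ k p))))
    (trans (cancel (+ c) (+ k) (+ p)) (sym (ℤ.pos-+ k p)))

F⊥-𝔹-partial-sum : ∀ m c x →
  F⊥ (+ (m ℕ.+ c)) (𝔹 (+ m) x) ≋ N.Σ< (suc (m ℕ.+ c)) (λ j → 𝔹 (- + c + + j) (F⊥ (+ j) x))
F⊥-𝔹-partial-sum m c x = begin
  F⊥ (+ r) (𝔹 (+ m) x)                                        ≈⟨ F⊥-𝔹 (+ m) r x ⟩
  N.Σ< (suc r) (λ k → 𝔹 (+ m - + k) (F⊥ (+ r - + k) x))      ≈⟨ N.Σ<-reverse (suc r) _ ⟩
  N.Σ< (suc r) (λ j → 𝔹 (+ m - + (r ∸ j)) (F⊥ (+ r - + (r ∸ j)) x))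
    ≈⟨ N.Σ<-cong (suc r) (λ j j≤r → ≡⇒≋ (reindex j (ℕ.≤-pred j≤r))) ⟩
  N.Σ< (suc r) (λ j → 𝔹 (- + c + + j) (F⊥ (+ j) x))          ∎
  where
  open ≋-Reasoning
  r = m ℕ.+ c
  cancel : ∀ m c j → m - (m + c - j) ≡ - c + j
  cancel = ℤ-Solver.solve-∀
  reindex : ∀ j → j ℕ.≤ r → 𝔹 (+ m - + (r ∸ j)) (F⊥ (+ r - + (r ∸ j)) x) ≡ 𝔹 (- + c + + j) (F⊥ (+ j) x)
  reindex j j≤r = cong₂ (λ i k → 𝔹 i (F⊥ k x))
    (trans (cong (λ k → + m - k) (trans (sym (+r-+k j≤r)) (cong (_- + j) (ℤ.pos-+ m c)))) (cancel (+ m) (+ c) (+ j)))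
    (trans (+r-+k (ℕ.m∸n≤m r j)) (cong +_ (ℕ.m∸[m∸n]≡n j≤r)))

𝔹-recursion : ∀ c x → 𝔹 (- + c) x ⊕ Σ𝔹F (- + c + + 1) (+ c) x ≋ HL (- + c) x
𝔹-recursion c x = ≋-trans (⊕-cong first-term ≋-refl) (𝔹-partial-sums c 1 x)
  where
  first-term : 𝔹 (- + c) x ≋ 𝔹 (- + c + + 0) (F⊥ (+ 0) x)
  first-term = ≋-trans (≡⇒≋ (cong (λ b → 𝔹 b x) (sym (ℤ.+-identityʳ (- + c))))) (𝔹-resp (- + c + + 0) (≋-sym (F⊥-0 x)))

F⊥-𝔹-tail : ∀ m c x → F⊥ (+ (m ℕ.+ c)) (𝔹 (+ m) x) ⊕ Σ𝔹F (+ m + + 1) (+ c) x ≋ HL (- + c) x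
F⊥-𝔹-tail m c x = ≋-trans
  (⊕-cong (F⊥-𝔹-partial-sum m c x) (≡⇒≋ (cong (λ b → Σ𝔹F b (+ c) x) start)))
  (𝔹-partial-sums c (suc (m ℕ.+ c)) x)
  where
  cancel : ∀ m c → m + + 1 ≡ - c + (+ 1 + (m + c))
  cancel = ℤ-Solver.solve-∀
  start : + m + + 1 ≡ - + c + + suc (m ℕ.+ c)
  start = trans (cancel (+ m) (+ c)) (cong (λ k → - + c + (+ 1 + k)) (sym (ℤ.pos-+ m c)))

corollary2p6 : (s m r : ℕ) → 0 < s → 0 < m →
    ((x : NSym) → Σ𝔹F (+ 0) (+ 0) x ≈ x)
    × ((x : NSym) → Σ𝔹F (- (+ s)) (+ s) x ≈ 0N)
    × ((x : NSym) → 𝔹 (+ 0) x ≈ (x ⊖ Σ𝔹F (+ 1) (+ 0) x))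
    × ((x : NSym) → 𝔹 (- (+ s)) x ≈ (⊖ Σ𝔹F (- (+ s) + + 1) (+ s) x))
    × (r < m → (x : NSym) →
         F⊥ (+ r) (𝔹 (+ m) x)
           ≈ sumℕ (suc r) (λ i → 𝔹 (+ m - + i) (F⊥ (+ r - + i) x)))
    × ((x : NSym) → F⊥ (+ m) (𝔹 (+ m) x) ≈ (x ⊖ Σ𝔹F (+ m + + 1) (+ 0) x))
    × (m < r → (x : NSym) →
         F⊥ (+ r) (𝔹 (+ m) x) ≈ (⊖ Σ𝔹F (+ m + + 1) (+ (r ∸ m)) x))
corollary2p6 (suc s) m r _ _ =
    (λ x → coeff-≡ (𝔹-partial-sums 0 0 x))
  , (λ x → coeff-≡ (𝔹-partial-sums (suc s) 0 x))
  , (λ x → coeff-≡ (recursion 0 x))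
  , (λ x → coeff-≡ (recursion (suc s) x))
  , (λ _ x → coeff-≡ (≋-trans (F⊥-𝔹 (+ m) r x) (≡⇒≋ (sym (sumℕ≡Σ< (suc r) _)))))
  , (λ x → coeff-≡ (tail 0 (ℕ.+-identityʳ m) x))
  , (λ m<r x → coeff-≡ (above m<r x))
  where
  recursion : ∀ c x → 𝔹 (- + c) x ≋ HL (- + c) x ⊖ Σ𝔹F (- + c + + 1) (+ c) x
  recursion c x = ⊕-⊖-transpose (𝔹-recursion c x)
  tail : ∀ c {n} → m ℕ.+ c ≡ n → ∀ x → F⊥ (+ n) (𝔹 (+ m) x) ≋ HL (- + c) x ⊖ Σ𝔹F (+ m + + 1) (+ c) x
  tail c refl x = ⊕-⊖-transpose (F⊥-𝔹-tail m c x)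
  above : m < r → ∀ x → F⊥ (+ r) (𝔹 (+ m) x) ≋ ⊖ Σ𝔹F (+ m + + 1) (+ (r ∸ m)) x
  above m<r x with r ∸ m | ℕ.m+[n∸m]≡n (ℕ.<⇒≤ m<r) | ℕ.m<n⇒0<n∸m m<r
  ... | suc c | m+c≡r | _ = tail (suc c) m+c≡r x
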